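{- Let $\mathbf{g}\in E$. Then $\mathcal{I}_{\mathbf{g}}$ is a nilpotent two-sided ideal of the $\mathbb{F}$-algebra $E^*_{\mathbf{g}}\mathbb{T}E^*_{\mathbf{g}}$, and its nilpotent index equals $|\{a\in S_1(\mathbf{g}):p\mid m_a-1\}|+|\{a\in S_2(\mathbf{g}):p\mid(\ell_a-1)m_a\}|+1$.
   Context: Let $\mathbb{F}$ be a field of characteristic $p$ ($p=0$ or a prime). For an integer $a$ let $\overline{a}$ be its image in $\mathbb{F}$; write $p\mid a$ if $\overline a=0$ and $p\nmid a$ otherwise. Fix $n\ge1$ and integers $\ell_1,\dots,\ell_n,m_1,\dots,m_n\ge2$. For each $i\in\{1,\dots,n\}$ let $U_i$ be a set with $|U_i|=\ell_im_i$ partitioned into $\ell_i$ blocks of size $m_i$, with relations $R^i_0=\{(a,a)\}$, $R^i_1=\{(a,b):a\ne b\text{ in the same block}\}$, $R^i_2=\{(a,b):a,b\text{ in different blocks}\}$. Let $X=\prod_iU_i$, $E$ the set of $n$-tuples with entries in $\{0,1,2\}$, $R_{\mathbf{g}}=\{(\mathbf{a},\mathbf{b}):(\mathbf{a}_i,\mathbf{b}_i)\in R^i_{\mathbf{g}_i}\ \forall i\}$. For $\mathbf{g}\in E$, $j\in\{0,1,2\}$ put $S_j(\mathbf{g})=\{a:\mathbf{g}_a=j\}$; for $V\subseteq\{1,\dots,n\}$ put $V^\bullet=\{a\in V:\ell_a>2\}$, $V^\circ=\{a\in V:m_a>2\}$. Fix $\mathbf{x}\in X$; $A_{\mathbf{g}}\in\mathrm{M}_X(\mathbb{F})$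 is the $0/1$ adjacency matrix of $R_{\mathbf{g}}$, $E^*_{\mathbf{g}}$ the diagonal matrix with $(\mathbf{y},\mathbf{y})$-entry $\overline1$ iff $(\mathbf{x},\mathbf{y})\in R_{\mathbf{g}}$, $\mathbb{T}$ the $\mathbb{F}$-subalgebra of $\mathrm{M}_X(\mathbb{F})$ generated by all $A_{\mathbf{g}},E^*_{\mathbf{g}}$, and $E^*_{\mathbf{g}}\mathbb{T}E^*_{\mathbf{g}}=\{E^*_{\mathbf{g}}ME^*_{\mathbf{g}}:M\in\mathbb{T}\}$ (an algebra with identity $E^*_{\mathbf{g}}$); $O$ is the zero matrix. For $\mathbf{g},\mathbf{h}\in E$, $\mathcal{U}_{\mathbf{g},\mathbf{h}}$ is the set of triples $(J_1,J_2,J_3)$ of subsets with $J_1\subseteq(S_1(\mathbf{g})\cap S_1(\mathbf{h}))^\circ$, $J_2\subseteq(S_2(\mathbf{g})\cap S_2(\mathbf{h}))^\bullet$, $J_2\subseteq J_3\subseteq S_2(\mathbf{g})\cap S_2(\mathbf{h})$. For $\tau=(J_1,J_2,J_3)\in\mathcal{U}_{\mathbf{g},\mathbf{h}}$, $B_{\mathbf{g},\mathbf{h},\tau}=\sum E^*_{\mathbf{g}}A_{\mathbf{a}}E^*_{\mathbf{h}}$ over all $\mathbf{a}\in E$ with $E^*_{\mathbf{g}}A_{\mathbf{a}}E^*_{\mathbf{h}}\ne O$, $S_1(\mathbf{a})\cap(S_1(\mathbf{g})\cap S_1(\mathbf{h}))^\circ\subseteq J_1$, $S_2(\mathbf{a})\cap(S_2(\mathbf{g})\cap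 S_2(\mathbf{h}))^\bullet\subseteq J_2$, $S_1(\mathbf{a})\cap S_2(\mathbf{g})\cap S_2(\mathbf{h})\subseteq J_3$, and $k_\tau=\prod_{j\in J_1}(m_j-1)\prod_{j\in J_2}(\ell_j-1)m_j\prod_{j\in J_3\setminus J_2}m_j$ (empty products $=1$). $\mathcal{I}_{\mathbf{g}}$ is the $\mathbb{F}$-span of $\{B_{\mathbf{g},\mathbf{g},\tau}:\tau\in\mathcal{U}_{\mathbf{g},\mathbf{g}},\ p\mid k_\tau\}$. The nilpotent index of a nilpotent ideal is the least $h\ge1$ such that every product of $h$ of its elements is zero. -}

module Defs where

open import Level using (Level; _⊔_) renaming (suc to lsuc)
open import Algebra.Bundles using (CommutativeRing)
open import Data.Nat using (ℕ; zero; suc; _≤_; _<_; _∸_; _<?_) renaming (_*_ to _*ℕ_; _+_ to _+ℕ_)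
open import Data.Nat.Divisibility using (_∣_; _∣?_)
open import Data.Nat.Primality using (Prime)
open import Data.Fin using (Fin; zero; suc)
open import Data.Fin.Properties using (all?) renaming (_≟_ to _≟F_)
open import Data.Fin.Subset using (Subset; _∈_; _⊆_; _─_; inside; outside)
open import Data.Fin.Subset.Properties using (_∈?_)
open import Data.Bool using (Bool; true; false; if_then_else_; _∧_)
open import Data.List using (List; []; _∷_; [_]; map; concatMap; cartesianProduct; foldr; filter; length)
open import Data.Bool.ListAction using (any)
open import Data.List.Base using () renaming (allFin to allFinL)
open import Data.Vec using (Vec; []; _∷_)
open import Data.Vec.Relation.Unary.All using (All)
open import Data.Product using (Σ; ∃; _×_; _,_)
open import Data.Sum using (_⊎_)
open import Relation.Nullary using (¬_; Dec; yes; no; does)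
open import Relation.Nullary.Decidable using (_×-dec_; _→-dec_)
open import Relation.Binary.PropositionalEquality using (_≡_)
open import Function.Bundles using (_⇔_)

record Field (c ℓ : Level) : Set (lsuc (c ⊔ ℓ)) where
  field
    commutativeRing : CommutativeRing c ℓ
  open CommutativeRing commutativeRing public
  field
    1≉0     : ¬ (1# ≈ 0#)
    inverse : ∀ x → ¬ (x ≈ 0#) → ∃ λ y → (x * y) ≈ 1#

module _ {c ℓ} (F : Field c ℓ) where
  open Field F
  ι : ℕ → Carrier
  ι zero    = 0#
  ι (suc a) = 1# + ι a

-- F has characteristic p  (p = 0 or p prime), i.e. the image of a
-- natural number a in F is zero iff p ∣ a  (0 ∣ a iff a = 0).
IsCharacteristic : ∀ {c ℓ} → Field c ℓ → ℕ → Set ℓ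
IsCharacteristic F p =
  (p ≡ 0 ⊎ Prime p) × (∀ a → (Field._≈_ F (ι F a) (Field.0# F)) ⇔ (p ∣ a))

allFun : (k : ℕ) (A : Fin k → Set) → ((i : Fin k) → List (A i)) → List ((i : Fin k) → A i)
allFun zero    A e = [ (λ ()) ]
allFun (suc k) A e =
  concatMap (λ a → map (λ f → cons a f) (allFun k (λ i → A (suc i)) (λ i → e (suc i)))) (e zero)
  where
  cons : A zero → ((i : Fin k) → A (suc i)) → (i : Fin (suc k)) → A i
  cons a f zero    = a
  cons a f (suc i) = f i

countFin : (k : ℕ) (P : Fin k → Set) → ((i : Fin k) → Dec (P i)) → ℕ
countFin k P P? = length (filter P? (allFinL k))

prodSub : ∀ {k} → Subset k → (Fin k → ℕ) → ℕ
prodSub []            f = 1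
prodSub (true  ∷ J)   f = f zero *ℕ prodSub J (λ i → f (suc i))
prodSub (false ∷ J)   f = prodSub J (λ i → f (suc i))

𝟘 𝟙 𝟚 : Fin 3
𝟘 = zero
𝟙 = suc zero
𝟚 = suc (suc zero)

-- U_i : ℓ_i blocks of size m_i; an element is (block , position in block)
U : (n : ℕ) (L M : Fin n → ℕ) → Fin n → Set
U n L M i = Fin (L i) × Fin (M i)

Pt : (n : ℕ) (L M : Fin n → ℕ) → Set
Pt n L M = (i : Fin n) → U n L M i

E : ℕ → Set
E n = Fin n → Fin 3

rel : ∀ {l m} → Fin l × Fin m → Fin l × Fin m → Fin 3
rel (b₁ , q₁) (b₂ , q₂) with b₁ ≟F b₂ | q₁ ≟F q₂
... | yes _ | yes _ = 𝟘
... | yes _ | no  _ = 𝟙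
... | no  _ | _     = 𝟚

_≟E_ : ∀ {n} (g h : E n) → Dec (∀ i → g i ≡ h i)
g ≟E h = all? (λ i → g i ≟F h i)

module Scheme {c ℓ} (F : Field c ℓ) (n : ℕ) (L M : Fin n → ℕ) (x : Pt n L M) where
  open Field F using (Carrier; 0#; 1#) renaming (_≈_ to _≈F_; _+_ to _⊕_; _*_ to _⊗_)

  X : Set
  X = Pt n L M

  allX : List X
  allX = allFun n (U n L M) (λ i → cartesianProduct (allFinL (L i)) (allFinL (M i)))

  allE : List (E n)
  allE = allFun n (λ _ → Fin 3) (λ _ → allFinL 3)

  -- (y , z) ∈ R_g  iff  relE y z = g
  relE : X → X → E n
  relE y z i = rel (y i) (z i)

  inR : E n → X → X → Bool
  inR g y z = does (relE y z ≟E g)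

  Mat : Set c
  Mat = X → X → Carrier

  _≈M_ : Mat → Mat → Set ℓ
  A ≈M B = ∀ y z → A y z ≈F B y z

  sumX : (X → Carrier) → Carrier
  sumX f = foldr (λ w acc → f w ⊕ acc) 0# allX

  O : Mat
  O y z = 0#

  -- identity matrix: (y , z) ∈ R_(0,…,0) iff y = z
  Id : Mat
  Id y z = if inR (λ _ → 𝟘) y z then 1# else 0#

  _+M_ : Mat → Mat → Mat
  (A +M B) y z = A y z ⊕ B y z

  _·M_ : Carrier → Mat → Mat
  (k ·M A) y z = k ⊗ A y z

  _⊙_ : Mat → Mat → Mat
  (A ⊙ B) y z = sumX (λ w → A y w ⊗ B w z)

  sumMats : List Mat → Mat
  sumMats = foldr _+M_ O

  Adj : E n → Mat
  Adj g y z = if inR g y z then 1# else 0#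

  Es : E n → Mat
  Es g y z = if inR (λ _ → 𝟘) y z ∧ inR g x y then 1# else 0#

  data InT : Mat → Set (c ⊔ ℓ) where
    genA : ∀ g → InT (Adj g)
    genE : ∀ g → InT (Es g)
    one  : InT Id
    zer  : InT O
    add  : ∀ {A B} → InT A → InT B → InT (A +M B)
    scl  : ∀ k {A} → InT A → InT (k ·M A)
    mul  : ∀ {A B} → InT A → InT B → InT (A ⊙ B)
    resp : ∀ {A B} → A ≈M B → InT A → InT B

  InETE : E n → Mat → Set (c ⊔ ℓ)
  InETE g A = Σ Mat λ B → InT B × (A ≈M ((Es g ⊙ B) ⊙ Es g))

  Tau : Set
  Tau = Subset n × Subset n × Subset n

  ValidTau : E n → E n → Tau → Set
  ValidTau g h (J₁ , J₂ , J₃) =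
      (∀ i → i ∈ J₁ → g i ≡ 𝟙 × h i ≡ 𝟙 × 2 < M i)
    × (∀ i → i ∈ J₂ → g i ≡ 𝟚 × h i ≡ 𝟚 × 2 < L i)
    × (J₂ ⊆ J₃)
    × (∀ i → i ∈ J₃ → g i ≡ 𝟚 × h i ≡ 𝟚)

  -- E*_g A_a E*_h ≠ O: some entry (y , z) equals 1, i.e.
  -- (x,y) ∈ R_g, (y,z) ∈ R_a, (x,z) ∈ R_h  (entries are 0 or 1, and 1 ≠ 0)
  nonzeroB : E n → E n → E n → Bool
  nonzeroB g a h = any (λ y → any (λ z → inR g x y ∧ inR a y z ∧ inR h x z) allX) allX

  CondB : E n → E n → Tau → E n → Set
  CondB g h (J₁ , J₂ , J₃) a = ∀ i →
      (a i ≡ 𝟙 → g i ≡ 𝟙 → h i ≡ 𝟙 → 2 < M i → i ∈ J₁)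
    × (a i ≡ 𝟚 → g i ≡ 𝟚 → h i ≡ 𝟚 → 2 < L i → i ∈ J₂)
    × (a i ≡ 𝟙 → g i ≡ 𝟚 → h i ≡ 𝟚 → i ∈ J₃)

  condB? : ∀ g h τ a → Dec (CondB g h τ a)
  condB? g h (J₁ , J₂ , J₃) a = all? λ i →
      ((a i ≟F 𝟙) →-dec (g i ≟F 𝟙) →-dec (h i ≟F 𝟙) →-dec (2 <? M i) →-dec (i ∈? J₁))
    ×-dec ((a i ≟F 𝟚) →-dec (g i ≟F 𝟚) →-dec (h i ≟F 𝟚) →-dec (2 <? L i) →-dec (i ∈? J₂))
    ×-dec ((a i ≟F 𝟙) →-dec (g i ≟F 𝟚) →-dec (h i ≟F 𝟚) →-dec (i ∈? J₃))

  B : E n → E n → Tau → Mat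
  B g h τ = sumMats (map (λ a → if nonzeroB g a h ∧ does (condB? g h τ a)
                                   then (Es g ⊙ Adj a) ⊙ Es h else O) allE)

  k : Tau → ℕ
  k (J₁ , J₂ , J₃) = prodSub J₁ (λ j → M j ∸ 1)
                 *ℕ prodSub J₂ (λ j → (L j ∸ 1) *ℕ M j)
                 *ℕ prodSub (J₃ ─ J₂) M

  -- ℐ_g : the F-span of { B_{g,g,τ} : τ ∈ 𝒰_{g,g}, p ∣ k_τ }  (p ∣ k_τ means image of k_τ is 0)
  data InI (g : E n) : Mat → Set (c ⊔ ℓ) where
    gen  : ∀ τ → ValidTau g g τ → ι F (k τ) ≈F 0# → InI g (B g g τ)
    zer  : InI g O
    add  : ∀ {A C} → InI g A → InI g C → InI g (A +M C)
    scl  : ∀ t {A} → InI g A → InI g (t ·M A)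
    resp : ∀ {A C} → A ≈M C → InI g A → InI g C

  record IsTwoSidedIdeal (S P : Mat → Set (c ⊔ ℓ)) : Set (c ⊔ ℓ) where
    field
      sub   : ∀ A → P A → S A
      zero∈ : P O
      +∈    : ∀ A C → P A → P C → P (A +M C)
      ·∈    : ∀ t A → P A → P (t ·M A)
      left  : ∀ A C → P A → S C → P (C ⊙ A)
      right : ∀ A C → P A → S C → P (A ⊙ C)

  prodV : ∀ {r} → Vec Mat r → Mat
  prodV []       = Id
  prodV (A ∷ As) = A ⊙ prodV As

  ProdsZero : (Mat → Set (c ⊔ ℓ)) → ℕ → Set (c ⊔ ℓ)
  ProdsZero P r = (As : Vec Mat r) → All P As → prodV As ≈M O

  NilpotentIndex : (Mat → Set (c ⊔ ℓ)) → ℕ → Set (c ⊔ ℓ)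
  NilpotentIndex P h = 1 ≤ h × ProdsZero P h × (∀ r → 1 ≤ r → r < h → ¬ ProdsZero P r)

  claimedIndex : (p : ℕ) → E n → ℕ
  claimedIndex p g =
      countFin n (λ a → g a ≡ 𝟙 × p ∣ (M a ∸ 1)) (λ a → (g a ≟F 𝟙) ×-dec (p ∣? (M a ∸ 1)))
    +ℕ countFin n (λ a → g a ≡ 𝟚 × p ∣ ((L a ∸ 1) *ℕ M a)) (λ a → (g a ≟F 𝟚) ×-dec (p ∣? ((L a ∸ 1) *ℕ M a)))
    +ℕ 1

-- Everything factorises over the coordinates. At a coordinate with g_i = G let R_G(x₀) be the points in
-- relation G to the base point. Restricted to R_G(x₀) × R_G(x₀), the identity, the same-block relation and the
-- all-ones matrix (shapes diag ≤ block ≤ full) multiply as F_s F_t = κ_G(s ⊓ t) F_(s ⊔ t), so their tensor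
-- products satisfy T_s T_t = (∏_i κ(s_i ⊓ t_i)) T_(s ⊔ t). Every element of E*_g 𝕋 E*_g is a combination of
-- these T_s: the coordinatewise stabiliser of x fixes every matrix of 𝕋 and acts transitively on pairs with a
-- given relation profile, so such a matrix is a combination of the E*_g A_a E*_g, which expand into T_s.
-- Call coordinate i bad for s when p ∣ κ_(g_i)(s_i). Each B_{g,g,τ} is some T_s with k_τ = ∏_i κ(s_i), so ℐ_g
-- is the span of the T_s with a bad coordinate. In a product T_s T_t either some coordinate is bad for both,
-- and the scalar vanishes, or the bad coordinates of s ⊔ t include the disjoint union of those of s and t.
-- Hence h factors from ℐ_g multiply into the span of the T_s with h bad coordinates, which is zero beyond the
-- number c of coordinates that can be bad; and the c tensors that are full at one bad coordinate each multiply,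
-- with scalar 1, to a T_s with a nonzero diagonal entry.
module Submission where

open import Defs

open import Algebra.Bundles using (CommutativeRing)
import Algebra.Properties.CommutativeMonoid.Sum as CommutativeMonoidSum
import Algebra.Solver.CommutativeMonoid
open import Data.Bool using (Bool; true; false; if_then_else_; _∧_; not)
open import Data.Bool.Properties using (∧-zeroʳ; T-≡)
open import Data.Empty using (⊥-elim)
open import Data.Fin using (Fin; zero; suc)
import Data.Fin.Permutation as Perm
open import Data.Fin.Permutation using (Permutation′; _⟨$⟩ʳ_; _⟨$⟩ˡ_)
open import Data.Fin.Properties using (punchInᵢ≢i; all?; any?; ¬∀⟶∃¬) renaming (_≟_ to _≟F_)
open import Data.Fin.Subset using (Subset; _─_; _∈_)
open import Data.Fin.Subset.Properties using (_∈?_)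
open import Data.List using (List; []; _∷_; map; concat; concatMap; cartesianProduct; foldr; _++_; filter; length)
open import Data.List.Base using (tabulate) renaming (allFin to allFinL)
open import Data.List.Membership.Propositional using (find; lose) renaming (_∈_ to _∈ₗ_)
open import Data.List.Membership.Propositional.Properties using (∈-cartesianProduct⁺; ∈-allFin; ∈-filter⁻; ∈-++⁻)
open import Data.List.Properties using (map-tabulate; length-++)
import Data.List.Relation.Unary.All as All
open import Data.List.Relation.Unary.AllPairs using (_∷_)
open import Data.List.Relation.Unary.Any as Any using (Any; here; there; satisfied) renaming (any? to anyₗ?)
import Data.List.Relation.Unary.Any.Properties as Anyₚ
open import Data.List.Relation.Unary.Unique.Propositional using (Unique)
import Data.List.Relation.Unary.Unique.Propositional.Properties as Unique
open import Data.Nat using (ℕ; zero; suc; _≤_; _<_; _<?_; _<ᵇ_; _∸_; z≤n; s≤s) renaming (_+_ to _+ℕ_; _*_ to _*ℕ_)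
open import Data.Nat.Divisibility using (_∣_; _∣?_; ∣-refl; ∣-trans; n∣m*n; 1∣_)
import Data.Nat.Properties as ℕₚ
open import Data.Nat.Properties
  using (<ᵇ-reflects-<; <⇒≱; +-mono-≤; +-monoʳ-≤; ≤∧≮⇒≡; m≤n⇒m≤1+n; n≤1+n; +-suc; ≤-reflexive; ≤-trans)
open import Data.Product using (Σ; ∃; _×_; _,_; proj₁; proj₂)
open import Data.Sum using (_⊎_; inj₁; inj₂; [_,_]′)
import Data.Vec as Vec
open import Data.Vec using (Vec; []; _∷_)
open import Data.Vec.Relation.Unary.All using (All; []; _∷_)
open import Function using (_∘_)
open import Function.Bundles using (Equivalence; mk⇔)
open import Level using (0ℓ; _⊔_)
open import Relation.Binary.Bundles using (Setoid)
open import Relation.Binary.PropositionalEquality as ≡ using (_≡_; _≢_)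
open import Relation.Nullary using (¬_; Dec; yes; no; does; proof; contradiction; ofʸ; ofⁿ)
open import Relation.Nullary.Decidable using (dec-true; dec-false; does-⇔; _×-dec_; _→-dec_)
open import Relation.Nullary.Reflects using (Reflects; invert)
open import Relation.Unary using (Pred; Decidable)

module _ {A : Set} where

  count : {P : Pred A 0ℓ} → Decidable P → List A → ℕ
  count P? xs = length (filter P? xs)

  module _ {P Q R : Pred A 0ℓ} (P? : Decidable P) (Q? : Decidable Q) (R? : Decidable R) where

    count-+-disjoint : (∀ a → P a → R a) → (∀ a → Q a → R a) → (∀ a → P a → ¬ Q a) →
                       ∀ xs → count P? xs +ℕ count Q? xs ≤ count R? xs
    count-+-disjoint P⇒R Q⇒R P#Q [] = z≤n
    count-+-disjoint P⇒R Q⇒R P#Q (x ∷ xs) with P? x | Q? x | R? x | count-+-disjoint P⇒R Q⇒R P#Q xs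
    ... | yes px | yes qx | _      | _  = ⊥-elim (P#Q x px qx)
    ... | yes px | no _   | no ¬rx | _  = ⊥-elim (¬rx (P⇒R x px))
    ... | no _   | yes qx | no ¬rx | _  = ⊥-elim (¬rx (Q⇒R x qx))
    ... | yes _  | no _   | yes _  | ih = s≤s ih
    ... | no _   | yes _  | yes _  | ih = ≤-trans (≤-reflexive (+-suc _ _)) (s≤s ih)
    ... | no _   | no _   | yes _  | ih = m≤n⇒m≤1+n ih
    ... | no _   | no _   | no _   | ih = ih

    count-⊆-+ : (∀ a → P a → Q a ⊎ R a) → ∀ xs → count P? xs ≤ count Q? xs +ℕ count R? xs
    count-⊆-+ P⇒Q∪R [] = z≤n
    count-⊆-+ P⇒Q∪R (x ∷ xs) with P? x | Q? x | R? x | count-⊆-+ P⇒Q∪R xs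
    ... | yes _  | yes _  | no _   | ih = s≤s ih
    ... | yes _  | no _   | yes _  | ih = ≤-trans (s≤s ih) (≤-reflexive (≡.sym (+-suc _ _)))
    ... | yes _  | yes _  | yes _  | ih = s≤s (≤-trans ih (+-monoʳ-≤ _ (n≤1+n _)))
    ... | no _   | no _   | no _   | ih = ih
    ... | no _   | yes _  | no _   | ih = m≤n⇒m≤1+n ih
    ... | no _   | no _   | yes _  | ih = ≤-trans ih (+-monoʳ-≤ _ (n≤1+n _))
    ... | no _   | yes _  | yes _  | ih = m≤n⇒m≤1+n (≤-trans ih (+-monoʳ-≤ _ (n≤1+n _)))
    ... | yes px | no ¬qx | no ¬rx | _  = ⊥-elim ([ ¬qx , ¬rx ]′ (P⇒Q∪R x px))

  count≥1⇒∃ : {P : Pred A 0ℓ} (P? : Decidable P) → ∀ xs → 1 ≤ count P? xs → ∃ P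
  count≥1⇒∃ P? (x ∷ xs) pos with P? x
  ... | yes px = x , px
  ... | no _   = count≥1⇒∃ P? xs pos

  ∈⇒count≥1 : {P : Pred A 0ℓ} (P? : Decidable P) → ∀ {a} xs → a ∈ₗ xs → P a → 1 ≤ count P? xs
  ∈⇒count≥1 P? (x ∷ xs) a∈ pa with P? x
  ... | yes _ = s≤s z≤n
  ∈⇒count≥1 P? (x ∷ xs) (here ≡.refl) pa | no ¬px = ⊥-elim (¬px pa)
  ∈⇒count≥1 P? (x ∷ xs) (there a∈)  pa | no _   = ∈⇒count≥1 P? xs a∈ pa

allFun-complete : ∀ k (A : Fin k → Set) (e : ∀ i → List (A i)) → (∀ i (a : A i) → a ∈ₗ e i) →
                  (f : ∀ i → A i) → Any (λ f′ → ∀ i → f′ i ≡ f i) (allFun k A e)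
allFun-complete zero    A e e-complete f = here (λ ())
allFun-complete (suc k) A e e-complete f = Anyₚ.concat⁺ (Anyₚ.map⁺ (Any.map
  (λ { ≡.refl → Anyₚ.map⁺ (Any.map (λ f′≡ → λ { zero → ≡.refl ; (suc i) → f′≡ i }) tail-found) })
  (e-complete zero (f zero))))
  where
  tail-found : Any (λ f′ → ∀ i → f′ i ≡ f (suc i)) (allFun k (A ∘ suc) (e ∘ suc))
  tail-found = allFun-complete k (A ∘ suc) (e ∘ suc) (λ i → e-complete (suc i)) (λ i → f (suc i))

-- Finite sums and products

module FiniteSums {c ℓ} (R : CommutativeRing c ℓ) where
  open CommutativeRing R hiding (zero)
  open import Relation.Binary.Reasoning.Setoid setoid
  open import Algebra.Properties.CommutativeSemigroup +-commutativeSemigroup using ()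
    renaming (interchange to +-interchange)
  open import Algebra.Properties.CommutativeSemigroup *-commutativeSemigroup public using ()
    renaming (x∙yz≈y∙xz to x*yz≈y*xz; x∙yz≈z∙xy to x*yz≈z*xy)

  ⟦_⟧ : Bool → Carrier
  ⟦ b ⟧ = if b then 1# else 0#

  ⟦∧⟧ : ∀ b b′ → ⟦ b ∧ b′ ⟧ ≈ ⟦ b ⟧ * ⟦ b′ ⟧
  ⟦∧⟧ true  _ = sym (*-identityˡ _)
  ⟦∧⟧ false _ = sym (zeroˡ _)

  ⟦⟧-idem : ∀ b → ⟦ b ⟧ * ⟦ b ⟧ ≈ ⟦ b ⟧
  ⟦⟧-idem true  = *-identityˡ _
  ⟦⟧-idem false = zeroˡ _

  -- the shape of Defs.sumX, so that sumX f is sumL f allX by definition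
  sumL : ∀ {A : Set} → (A → Carrier) → List A → Carrier
  sumL f = foldr (λ a acc → f a + acc) 0#

  module _ {A : Set} where

    sumL-cong : ∀ {f g : A → Carrier} xs → (∀ a → f a ≈ g a) → sumL f xs ≈ sumL g xs
    sumL-cong []       f≈g = refl
    sumL-cong (x ∷ xs) f≈g = +-cong (f≈g x) (sumL-cong xs f≈g)

    sumL-distrib-+ : ∀ (f g : A → Carrier) xs → sumL (λ a → f a + g a) xs ≈ sumL f xs + sumL g xs
    sumL-distrib-+ f g []       = sym (+-identityˡ 0#)
    sumL-distrib-+ f g (x ∷ xs) = trans (+-congˡ (sumL-distrib-+ f g xs)) (+-interchange _ _ _ _)

    sumL-*ˡ : ∀ k (f : A → Carrier) xs → sumL (λ a → k * f a) xs ≈ k * sumL f xs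
    sumL-*ˡ k f []       = sym (zeroʳ k)
    sumL-*ˡ k f (x ∷ xs) = trans (+-congˡ (sumL-*ˡ k f xs)) (sym (distribˡ k (f x) (sumL f xs)))

    sumL-*ʳ : ∀ k (f : A → Carrier) xs → sumL (λ a → f a * k) xs ≈ sumL f xs * k
    sumL-*ʳ k f xs = trans (sumL-cong xs (λ a → *-comm (f a) k)) (trans (sumL-*ˡ k f xs) (*-comm k _))

    sumL-zero : ∀ (f : A → Carrier) xs → (∀ a → f a ≈ 0#) → sumL f xs ≈ 0#
    sumL-zero f []       f≈0 = refl
    sumL-zero f (x ∷ xs) f≈0 = trans (+-cong (f≈0 x) (sumL-zero f xs f≈0)) (+-identityˡ 0#)

    sumL-++ : ∀ (f : A → Carrier) xs ys → sumL f (xs ++ ys) ≈ sumL f xs + sumL f ys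
    sumL-++ f []       ys = sym (+-identityˡ _)
    sumL-++ f (x ∷ xs) ys = trans (+-congˡ (sumL-++ f xs ys)) (sym (+-assoc _ _ _))

  sumL-map : ∀ {A B : Set} (f : B → Carrier) (h : A → B) xs → sumL f (map h xs) ≡ sumL (f ∘ h) xs
  sumL-map f h []       = ≡.refl
  sumL-map f h (x ∷ xs) = ≡.cong (f (h x) +_) (sumL-map f h xs)

  sumL-concatMap : ∀ {A B : Set} (f : B → Carrier) (h : A → List B) xs →
                   sumL f (concatMap h xs) ≈ sumL (λ a → sumL f (h a)) xs
  sumL-concatMap f h []       = refl
  sumL-concatMap f h (x ∷ xs) =
    trans (sumL-++ f (h x) (concat (map h xs))) (+-congˡ (sumL-concatMap f h xs))

  sumL-cartesianProduct : ∀ {A B : Set} (f : A × B → Carrier) xs ys →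
    sumL f (cartesianProduct xs ys) ≈ sumL (λ a → sumL (λ b → f (a , b)) ys) xs
  sumL-cartesianProduct f []       ys = refl
  sumL-cartesianProduct f (x ∷ xs) ys =
    trans (sumL-++ f (map (x ,_) ys) (cartesianProduct xs ys))
          (+-cong (reflexive (sumL-map f (x ,_) ys)) (sumL-cartesianProduct f xs ys))

  open CommutativeMonoidSum +-commutativeMonoid public
    using (sum; sum-cong-≋; sum-permute; sum-remove; sum-replicate-zero)
  open import Algebra.Properties.Semiring.Sum semiring public using (*-distribˡ-sum)
  open CommutativeMonoidSum *-commutativeMonoid public
    using () renaming (sum to ∏; sum-cong-≋ to ∏-cong; ∑-distrib-+ to ∏-distrib-*; sum-replicate-zero to ∏-1)

  sumL-allFin : ∀ k (h : Fin k → Carrier) → sumL h (allFinL k) ≈ sum h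
  sumL-allFin zero    h = refl
  sumL-allFin (suc k) h = +-congˡ (begin
    sumL h (tabulate suc)          ≡⟨ ≡.cong (sumL h) (map-tabulate (λ i → i) suc) ⟨
    sumL h (map suc (allFinL k))   ≡⟨ sumL-map h suc (allFinL k) ⟩
    sumL (h ∘ suc) (allFinL k)     ≈⟨ sumL-allFin k (h ∘ suc) ⟩
    sum (h ∘ suc)                  ∎)

  ∏-zero : ∀ {k} (t : Fin k → Carrier) i → t i ≈ 0# → ∏ t ≈ 0#
  ∏-zero t zero    tᵢ≈0 = trans (*-congʳ tᵢ≈0) (zeroˡ _)
  ∏-zero t (suc i) tᵢ≈0 = trans (*-congˡ (∏-zero (t ∘ suc) i tᵢ≈0)) (zeroʳ _)

  sumL-concatMap-map : ∀ {A B C : Set} (f : C → Carrier) (h : A → B → C) xs ys →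
    sumL f (concatMap (λ a → map (h a) ys) xs) ≈ sumL (λ a → sumL (λ b → f (h a b)) ys) xs
  sumL-concatMap-map f h xs ys =
    trans (sumL-concatMap f _ xs) (sumL-cong xs (λ a → reflexive (sumL-map f (h a) ys)))

  sumL-allFun-∏ : ∀ k (A : Fin k → Set) (e : ∀ i → List (A i)) (t : ∀ i → A i → Carrier) →
    sumL (λ f → ∏ (λ i → t i (f i))) (allFun k A e) ≈ ∏ (λ i → sumL (t i) (e i))
  sumL-allFun-∏ zero    A e t = +-identityʳ 1#
  sumL-allFun-∏ (suc k) A e t =
    trans (sumL-concatMap-map _ _ (e zero) _)
    (trans (sumL-cong (e zero) (λ a → sumL-*ˡ (t zero a) (λ f → ∏ (λ i → t (suc i) (f i))) rest))
    (trans (sumL-*ʳ _ (t zero) (e zero))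
           (*-congˡ (sumL-allFun-∏ k (A ∘ suc) (e ∘ suc) (t ∘ suc)))))
    where rest = allFun k (A ∘ suc) (e ∘ suc)

  -- Defs.allFun builds its functions with a private cons that agrees with _◂_ below only pointwise;
  -- without function extensionality, F therefore has to respect pointwise equality.
  sumL-allFun-reindex : ∀ k (A : Fin k → Set) (e : ∀ i → List (A i)) (σ : ∀ i → A i → A i) →
    (∀ i (h : A i → Carrier) → sumL (h ∘ σ i) (e i) ≈ sumL h (e i)) →
    ∀ (F : (∀ i → A i) → Carrier) → (∀ f f′ → (∀ i → f i ≡ f′ i) → F f ≈ F f′) →
    sumL (λ f → F (λ i → σ i (f i))) (allFun k A e) ≈ sumL F (allFun k A e)
  sumL-allFun-reindex zero    A e σ σ-inv F F-resp = +-congʳ (F-resp _ _ (λ ()))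
  sumL-allFun-reindex (suc k) A e σ σ-inv F F-resp = begin
    sumL (λ f → F (λ i → σ i (f i))) (allFun (suc k) A e)
      ≈⟨ trans (sumL-concatMap-map _ _ (e zero) rest)
               (sumL-cong (e zero) λ a → sumL-cong rest λ f → F-resp _ _ λ { zero → ≡.refl ; (suc i) → ≡.refl }) ⟩
    sumL (λ a → sumL (λ f → F (σ zero a ◂ (λ i → σ (suc i) (f i)))) rest) (e zero)
      ≈⟨ sumL-cong (e zero) (λ a → sumL-allFun-reindex k (A ∘ suc) (e ∘ suc) (σ ∘ suc) (σ-inv ∘ suc)
                                     (F ∘ (σ zero a ◂_)) (λ f f′ f≡f′ → F-resp _ _ (◂-cong f≡f′))) ⟩
    sumL (λ a → sumL (λ f → F (σ zero a ◂ f)) rest) (e zero)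
      ≈⟨ σ-inv zero (λ a → sumL (λ f → F (a ◂ f)) rest) ⟩
    sumL (λ a → sumL (λ f → F (a ◂ f)) rest) (e zero)
      ≈⟨ trans (sumL-cong (e zero) λ a → sumL-cong rest λ f → F-resp _ _ λ { zero → ≡.refl ; (suc i) → ≡.refl })
               (sym (sumL-concatMap-map _ _ (e zero) rest)) ⟩
    sumL F (allFun (suc k) A e) ∎
    where
    rest = allFun k (A ∘ suc) (e ∘ suc)
    _◂_ : A zero → (∀ i → A (suc i)) → ∀ i → A i
    (a ◂ f) zero    = a
    (a ◂ f) (suc i) = f i
    ◂-cong : ∀ {a f f′} → (∀ i → f i ≡ f′ i) → ∀ i → (a ◂ f) i ≡ (a ◂ f′) i
    ◂-cong f≡f′ zero    = ≡.refl
    ◂-cong f≡f′ (suc i) = f≡f′ i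

  sum-zero : ∀ {k} (h : Fin k → Carrier) → (∀ i → h i ≈ 0#) → sum h ≈ 0#
  sum-zero {k} h h≈0 = trans (sum-cong-≋ h≈0) (sum-replicate-zero k)

  δ : ∀ {k} → Fin k → Fin k → Carrier
  δ i j = ⟦ does (i ≟F j) ⟧

  δ-refl : ∀ {k} (i : Fin k) → δ i i ≈ 1#
  δ-refl i = reflexive (≡.cong ⟦_⟧ (dec-true (i ≟F i) ≡.refl))

  δ-≢ : ∀ {k} {i j : Fin k} → i ≢ j → δ i j ≈ 0#
  δ-≢ {i = i} {j} i≢j = reflexive (≡.cong ⟦_⟧ (dec-false (i ≟F j) i≢j))

  δ-sym : ∀ {k} (i j : Fin k) → δ i j ≈ δ j i
  δ-sym i j with i ≟F j | j ≟F i
  ... | yes _   | yes _   = refl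
  ... | no _    | no _    = refl
  ... | yes i≡j | no j≢i  = contradiction (≡.sym i≡j) j≢i
  ... | no i≢j  | yes j≡i = contradiction (≡.sym j≡i) i≢j

  δ-transport : ∀ {k} (i j h : Fin k) → δ i j * δ j h ≈ δ i j * δ i h
  δ-transport i j h with i ≟F j
  ... | yes ≡.refl = refl
  ... | no _       = trans (zeroˡ _) (sym (zeroˡ _))

  ∑-δ : ∀ {k} (c : Fin k) (h : Fin k → Carrier) → sum (λ b → δ c b * h b) ≈ h c
  ∑-δ {suc k} zero    h = begin
    1# * h zero + sum (λ b → 0# * h (suc b))
      ≈⟨ +-cong (*-identityˡ _) (sum-zero (λ b → 0# * h (suc b)) (λ b → zeroˡ _)) ⟩
    h zero + 0#
      ≈⟨ +-identityʳ _ ⟩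
    h zero ∎
  ∑-δ {suc k} (suc c) h = begin
    0# * h zero + sum (λ b → δ c b * h (suc b))  ≈⟨ +-cong (zeroˡ _) (∑-δ c (h ∘ suc)) ⟩
    0# + h (suc c)                              ≈⟨ +-identityˡ _ ⟩
    h (suc c)                                   ∎

Fin≤2-≢⇒≡ : ∀ {k} → ¬ (2 < k) → (a b c : Fin k) → a ≢ c → b ≢ c → a ≡ b
Fin≤2-≢⇒≡ {suc (suc (suc _))} k≯2 _ _ _ _ _ = contradiction (s≤s (s≤s (s≤s z≤n))) k≯2
Fin≤2-≢⇒≡ _ zero       zero       _          _   _   = ≡.refl
Fin≤2-≢⇒≡ _ (suc zero) (suc zero) _          _   _   = ≡.refl
Fin≤2-≢⇒≡ _ zero       (suc zero) zero       a≢c _   = contradiction ≡.refl a≢c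
Fin≤2-≢⇒≡ _ zero       (suc zero) (suc zero) _   b≢c = contradiction ≡.refl b≢c
Fin≤2-≢⇒≡ _ (suc zero) zero       zero       _   b≢c = contradiction ≡.refl b≢c
Fin≤2-≢⇒≡ _ (suc zero) zero       (suc zero) a≢c _   = contradiction ≡.refl a≢c

another : ∀ {k} → 2 ≤ k → (a : Fin k) → Σ (Fin k) (λ b → a ≢ b)
another {suc (suc k)} _ zero    = suc zero , λ ()
another {suc (suc k)} _ (suc a) = zero , λ ()
another {suc zero} (s≤s ()) zero

module _ {k : ℕ} where

  does-≟-injective : ∀ (f : Fin k → Fin k) → (∀ {a b} → f a ≡ f b → a ≡ b) →
                     ∀ a b → does (f a ≟F f b) ≡ does (a ≟F b)
  does-≟-injective f f-inj a b with a ≟F b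
  ... | yes ≡.refl = dec-true (f a ≟F f a) ≡.refl
  ... | no a≢b     = dec-false (f a ≟F f b) (a≢b ∘ f-inj)

  permutation-injective : ∀ (π : Permutation′ k) {a b} → π ⟨$⟩ʳ a ≡ π ⟨$⟩ʳ b → a ≡ b
  permutation-injective π {a} {b} eq =
    ≡.trans (≡.sym (Perm.inverseˡ π)) (≡.trans (≡.cong (π ⟨$⟩ˡ_) eq) (Perm.inverseˡ π))

  does-≟-transfer : ∀ {a b c d : Fin k} → does (a ≟F b) ≡ does (c ≟F d) → a ≡ b → c ≡ d
  does-≟-transfer {a} {b} {c} {d} eq a≡b with c ≟F d
  ... | yes c≡d = c≡d
  ... | no _    = contradiction (≡.trans (≡.sym (dec-true (a ≟F b) a≡b)) eq) λ ()

  transpose-fixes : ∀ (i j w : Fin k) → (w ≡ i → w ≡ j) → (w ≡ j → w ≡ i) → Perm.transpose i j ⟨$⟩ʳ w ≡ w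
  transpose-fixes i j w w≡i⇒w≡j w≡j⇒w≡i with w ≟F i
  ... | yes w≡i = ≡.sym (w≡i⇒w≡j w≡i)
  ... | no w≢i with w ≟F j
  ...   | yes w≡j = contradiction (w≡j⇒w≡i w≡j) w≢i
  ...   | no _    = ≡.refl

  transpose-hits : ∀ (i j : Fin k) → Perm.transpose i j ⟨$⟩ʳ i ≡ j
  transpose-hits i j with i ≟F i
  ... | yes _   = ≡.refl
  ... | no i≢i  = contradiction ≡.refl i≢i

∈?-tabulate : ∀ {k} (f : Fin k → Bool) i → does (i ∈? Vec.tabulate f) ≡ f i
∈?-tabulate {suc k} f zero    with f zero
... | true  = ≡.refl
... | false = ≡.refl
∈?-tabulate {suc k} f (suc i) = ∈?-tabulate (f ∘ suc) i

∈-tabulate⁻ : ∀ {k} (f : Fin k → Bool) {i} → i ∈ Vec.tabulate f → f i ≡ true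
∈-tabulate⁻ f {i} i∈ = ≡.trans (≡.sym (∈?-tabulate f i)) (dec-true (i ∈? Vec.tabulate f) i∈)

∈-tabulate⁺ : ∀ {k} (f : Fin k → Bool) {i} → f i ≡ true → i ∈ Vec.tabulate f
∈-tabulate⁺ f {i} fi≡true =
  invert (≡.subst (Reflects _) (≡.trans (∈?-tabulate f i) fi≡true) (proof (i ∈? Vec.tabulate f)))

open CommutativeMonoidSum ℕₚ.*-1-commutativeMonoid using ()
  renaming (sum to ∏ℕ; ∑-distrib-+ to ∏ℕ-distrib-*; sum-cong-≗ to ∏ℕ-cong)

prodSub≡∏ℕ : ∀ {k} (J : Subset k) f → prodSub J f ≡ ∏ℕ (λ i → if does (i ∈? J) then f i else 1)
prodSub≡∏ℕ Vec.[]          f = ≡.refl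
prodSub≡∏ℕ (true Vec.∷ J)  f = ≡.cong (f zero *ℕ_) (prodSub≡∏ℕ J (f ∘ suc))
prodSub≡∏ℕ (false Vec.∷ J) f = ≡.trans (prodSub≡∏ℕ J (f ∘ suc)) (≡.sym (ℕₚ.*-identityˡ _))

∈?-─ : ∀ {k} (p q : Subset k) i → does (i ∈? (p ─ q)) ≡ does (i ∈? p) ∧ not (does (i ∈? q))
∈?-─ (true  Vec.∷ p) (true  Vec.∷ q) zero = ≡.refl
∈?-─ (true  Vec.∷ p) (false Vec.∷ q) zero = ≡.refl
∈?-─ (false Vec.∷ p) (true  Vec.∷ q) zero = ≡.refl
∈?-─ (false Vec.∷ p) (false Vec.∷ q) zero = ≡.refl
∈?-─ (_ Vec.∷ p) (_ Vec.∷ q)     (suc i) = ∈?-─ p q i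

module FieldFacts {c ℓ} (F : Field c ℓ) where
  open Field F hiding (zero)
  open FiniteSums commutativeRing
  open import Relation.Binary.Reasoning.Setoid setoid

  ι-+ : ∀ a b → ι F (a +ℕ b) ≈ ι F a + ι F b
  ι-+ zero    b = sym (+-identityˡ _)
  ι-+ (suc a) b = trans (+-congˡ (ι-+ a b)) (sym (+-assoc _ _ _))

  ι-* : ∀ a b → ι F (a *ℕ b) ≈ ι F a * ι F b
  ι-* zero    b = sym (zeroˡ _)
  ι-* (suc a) b = trans (ι-+ b (a *ℕ b)) (trans (+-cong (sym (*-identityˡ _)) (ι-* a b)) (sym (distribʳ _ _ _)))

  ι-1 : ι F 1 ≈ 1#
  ι-1 = +-identityʳ 1#

  ι-∏ℕ : ∀ {k} (t : Fin k → ℕ) → ι F (∏ℕ t) ≈ ∏ (λ i → ι F (t i))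
  ι-∏ℕ {zero}  t = ι-1
  ι-∏ℕ {suc k} t = trans (ι-* (t zero) (∏ℕ (t ∘ suc))) (*-congˡ (ι-∏ℕ (t ∘ suc)))

  sum-const : ∀ k a → sum {k} (λ _ → a) ≈ ι F k * a
  sum-const zero    a = sym (zeroˡ a)
  sum-const (suc k) a = trans (+-cong (sym (*-identityˡ a)) (sum-const k a)) (sym (distribʳ _ _ _))

  ∏-nonzero : ∀ {k} (t : Fin k → Carrier) → (∀ i → ¬ t i ≈ 0#) → ¬ ∏ t ≈ 0#
  ∏-nonzero {zero}  t t≉0 ∏≈0 = 1≉0 ∏≈0
  ∏-nonzero {suc k} t t≉0 ∏≈0 with inverse (t zero) (t≉0 zero)
  ... | t₀⁻¹ , t₀t₀⁻¹≈1 = ∏-nonzero (t ∘ suc) (t≉0 ∘ suc) (begin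
    ∏ (t ∘ suc)                     ≈⟨ *-identityˡ _ ⟨
    1# * ∏ (t ∘ suc)                ≈⟨ *-congʳ (trans (*-comm _ _) t₀t₀⁻¹≈1) ⟨
    (t₀⁻¹ * t zero) * ∏ (t ∘ suc)   ≈⟨ *-assoc _ _ _ ⟩
    t₀⁻¹ * (t zero * ∏ (t ∘ suc))   ≈⟨ *-congˡ ∏≈0 ⟩
    t₀⁻¹ * 0#                       ≈⟨ zeroʳ _ ⟩
    0#                              ∎)

  sum-except : ∀ {k} (i : Fin k) (h : Fin k → Carrier) {b} → (∀ j → i ≢ j → h j ≈ b) →
               sum h ≈ h i + ι F (k ∸ 1) * b
  sum-except {suc k} i h h≈b =
    trans (sum-remove h) (+-congˡ (trans (sum-cong-≋ (λ j → h≈b _ (punchInᵢ≢i i j ∘ ≡.sym))) (sum-const k _)))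

-- One coordinate: l blocks of size m

module Relations {l m : ℕ} where

  Point : Set
  Point = Fin l × Fin m

  relBits : Bool → Bool → Fin 3
  relBits true  true  = 𝟘
  relBits true  false = 𝟙
  relBits false _     = 𝟚

  rel≡relBits : ∀ (u v : Point) → rel u v ≡ relBits (does (proj₁ u ≟F proj₁ v)) (does (proj₂ u ≟F proj₂ v))
  rel≡relBits (b , q) (b′ , q′) with b ≟F b′ | q ≟F q′
  ... | yes _ | yes _ = ≡.refl
  ... | yes _ | no _  = ≡.refl
  ... | no _  | _     = ≡.refl

  rel-refl : ∀ (u : Point) → rel u u ≡ 𝟘
  rel-refl (b , q) with b ≟F b | q ≟F q
  ... | yes _ | yes _  = ≡.refl
  ... | yes _ | no q≢q = contradiction ≡.refl q≢q
  ... | no b≢b | _     = contradiction ≡.refl b≢b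

  rel-sym : ∀ (u v : Point) → rel u v ≡ rel v u
  rel-sym (b , q) (b′ , q′) with b ≟F b′ | q ≟F q′ | b′ ≟F b | q′ ≟F q
  ... | yes _ | yes _ | yes _ | yes _ = ≡.refl
  ... | yes _ | no _  | yes _ | no _  = ≡.refl
  ... | no _  | _     | no _  | _     = ≡.refl
  ... | yes e | _     | no ne | _     = contradiction (≡.sym e) ne
  ... | no ne | _     | yes e | _     = contradiction (≡.sym e) ne
  ... | yes _ | yes e | yes _ | no ne = contradiction (≡.sym e) ne
  ... | yes _ | no ne | yes _ | yes e = contradiction (≡.sym e) ne

  rel≡𝟘⇒≡ : ∀ (u v : Point) → rel u v ≡ 𝟘 → u ≡ v
  rel≡𝟘⇒≡ (b , q) (b′ , q′) r≡𝟘 with b ≟F b′ | q ≟F q′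
  rel≡𝟘⇒≡ (b , q) (b , q) ≡.refl | yes ≡.refl | yes ≡.refl = ≡.refl
  rel≡𝟘⇒≡ (b , q) (b′ , q′) ()     | yes _      | no _
  rel≡𝟘⇒≡ (b , q) (b′ , q′) ()     | no _       | _

  rel≡𝟙⇒ : ∀ (u v : Point) → rel u v ≡ 𝟙 → proj₁ u ≡ proj₁ v × proj₂ u ≢ proj₂ v
  rel≡𝟙⇒ (b , q) (b′ , q′) r≡𝟙 with b ≟F b′ | q ≟F q′
  rel≡𝟙⇒ (b , q) (b′ , q′) ≡.refl | yes b≡b′ | no q≢q′ = b≡b′ , q≢q′
  rel≡𝟙⇒ (b , q) (b′ , q′) ()     | yes _    | yes _
  rel≡𝟙⇒ (b , q) (b′ , q′) ()     | no _     | _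

  rel≡𝟚⇒ : ∀ (u v : Point) → rel u v ≡ 𝟚 → proj₁ u ≢ proj₁ v
  rel≡𝟚⇒ (b , q) (b′ , q′) r≡𝟚 with b ≟F b′ | q ≟F q′
  rel≡𝟚⇒ (b , q) (b′ , q′) ≡.refl | no b≢b′ | _ = b≢b′
  rel≡𝟚⇒ (b , q) (b′ , q′) ()     | yes _   | yes _
  rel≡𝟚⇒ (b , q) (b′ , q′) ()     | yes _   | no _

  rel-otherBlock : ∀ {b b′ : Fin l} (q q′ : Fin m) → b ≢ b′ → rel (b , q) (b′ , q′) ≡ 𝟚
  rel-otherBlock {b} {b′} q q′ b≢b′ with b ≟F b′
  ... | yes b≡b′ = contradiction b≡b′ b≢b′
  ... | no _     = ≡.refl

  rel-sameBlock : ∀ (b : Fin l) {q q′ : Fin m} → q ≢ q′ → rel (b , q) (b , q′) ≡ 𝟙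
  rel-sameBlock b {q} {q′} q≢q′ with b ≟F b | q ≟F q′
  ... | yes _  | yes q≡q′ = contradiction q≡q′ q≢q′
  ... | yes _  | no _     = ≡.refl
  ... | no b≢b | _        = contradiction ≡.refl b≢b

  relBits-injectiveˡ : ∀ β γ β′ γ′ → relBits β γ ≡ relBits β′ γ′ → β ≡ β′
  relBits-injectiveˡ true  true  true  _ _ = ≡.refl
  relBits-injectiveˡ true  false true  _ _ = ≡.refl
  relBits-injectiveˡ false _     false _ _ = ≡.refl
  relBits-injectiveˡ true  true  false _ ()
  relBits-injectiveˡ true  false false _ ()
  relBits-injectiveˡ false _     true  true ()
  relBits-injectiveˡ false _     true  false ()

  relBits-injectiveʳ : ∀ γ γ′ → relBits true γ ≡ relBits true γ′ → γ ≡ γ′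
  relBits-injectiveʳ true  true  _ = ≡.refl
  relBits-injectiveʳ false false _ = ≡.refl
  relBits-injectiveʳ true  false ()
  relBits-injectiveʳ false true  ()

  sameBlock-respects-rel : ∀ (w u u′ : Point) → rel w u′ ≡ rel w u →
                           does (proj₁ w ≟F proj₁ u′) ≡ does (proj₁ w ≟F proj₁ u)
  sameBlock-respects-rel w u u′ eq =
    relBits-injectiveˡ _ _ _ _ (≡.trans (≡.sym (rel≡relBits w u′)) (≡.trans eq (rel≡relBits w u)))

  samePosition-respects-rel : ∀ (w u u′ : Point) → proj₁ w ≡ proj₁ u′ → proj₁ w ≡ proj₁ u → rel w u′ ≡ rel w u →
                              does (proj₂ w ≟F proj₂ u′) ≡ does (proj₂ w ≟F proj₂ u)
  samePosition-respects-rel w u u′ w~u′ w~u eq = relBits-injectiveʳ _ _ (begin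
    relBits true (does (proj₂ w ≟F proj₂ u′))
      ≡⟨ ≡.cong (λ β → relBits β _) (dec-true (proj₁ w ≟F proj₁ u′) w~u′) ⟨
    relBits (does (proj₁ w ≟F proj₁ u′)) (does (proj₂ w ≟F proj₂ u′))
      ≡⟨ ≡.trans (≡.sym (rel≡relBits w u′)) (≡.trans eq (rel≡relBits w u)) ⟩
    relBits (does (proj₁ w ≟F proj₁ u)) (does (proj₂ w ≟F proj₂ u))
      ≡⟨ ≡.cong (λ β → relBits β _) (dec-true (proj₁ w ≟F proj₁ u) w~u) ⟩
    relBits true (does (proj₂ w ≟F proj₂ u)) ∎)
    where open ≡.≡-Reasoning

data Shape : Set where
  diag block full : Shape

_⊔ˢ_ : Shape → Shape → Shape
diag  ⊔ˢ t     = t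
block ⊔ˢ diag  = block
block ⊔ˢ block = block
block ⊔ˢ full  = full
full  ⊔ˢ t     = full

_⊓ˢ_ : Shape → Shape → Shape
diag  ⊓ˢ t     = diag
block ⊓ˢ diag  = diag
block ⊓ˢ block = block
block ⊓ˢ full  = block
full  ⊓ˢ t     = t

allows : Shape → Fin 3 → Bool
allows diag  r = does (r ≟F 𝟘)
allows block r = not (does (r ≟F 𝟚))
allows full  r = true

shapeOf : Bool → Bool → Bool → Shape
shapeOf true  _     _     = full
shapeOf false true  _     = full
shapeOf false false true  = block
shapeOf false false false = diag

⊔ˢ-comm : ∀ s t → s ⊔ˢ t ≡ t ⊔ˢ s
⊔ˢ-comm diag  diag  = ≡.refl
⊔ˢ-comm diag  block = ≡.refl
⊔ˢ-comm diag  full  = ≡.refl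
⊔ˢ-comm block diag  = ≡.refl
⊔ˢ-comm block block = ≡.refl
⊔ˢ-comm block full  = ≡.refl
⊔ˢ-comm full  diag  = ≡.refl
⊔ˢ-comm full  block = ≡.refl
⊔ˢ-comm full  full  = ≡.refl

⊓ˢ-sel : ∀ s t → s ⊓ˢ t ≡ s ⊎ s ⊓ˢ t ≡ t
⊓ˢ-sel diag  _     = inj₁ ≡.refl
⊓ˢ-sel block diag  = inj₂ ≡.refl
⊓ˢ-sel block block = inj₁ ≡.refl
⊓ˢ-sel block full  = inj₁ ≡.refl
⊓ˢ-sel full  _     = inj₂ ≡.refl

notDiag isFull : Shape → Bool
notDiag diag = false
notDiag _    = true
isFull full = true
isFull _    = false

LocallyValid : Set → Set → Set → Fin 3 → Set
LocallyValid A₁ A₂ A₃ G = (A₁ → G ≡ 𝟙) × (A₂ → G ≡ 𝟚) × (A₂ → A₃) × (A₃ → G ≡ 𝟚)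

allows-𝟘 : ∀ s → allows s 𝟘 ≡ true
allows-𝟘 diag  = ≡.refl
allows-𝟘 block = ≡.refl
allows-𝟘 full  = ≡.refl

allShapes : List Shape
allShapes = diag ∷ block ∷ full ∷ []

module ShapeExpansion {c ℓ} (R : CommutativeRing c ℓ) where
  open CommutativeRing R hiding (zero)
  open FiniteSums R
  open import Algebra.Properties.Ring ring using (-1*x≈-x; -0#≈0#)

  γ : Fin 3 → Shape → Carrier
  γ zero             diag  = 1#
  γ zero             block = 0#
  γ zero             full  = 0#
  γ (suc zero)       diag  = - 1#
  γ (suc zero)       block = 1#
  γ (suc zero)       full  = 0#
  γ (suc (suc zero)) diag  = 0#
  γ (suc (suc zero)) block = - 1#
  γ (suc (suc zero)) full  = 1#

  sumL-allShapes : ∀ (f : Shape → Carrier) → sumL f allShapes ≈ f diag + (f block + f full)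
  sumL-allShapes f = +-congˡ (+-congˡ (+-identityʳ _))

  γ-expansion : ∀ a r → ⟦ does (r ≟F a) ⟧ ≈ sumL (λ s → γ a s * ⟦ allows s r ⟧) allShapes
  γ-expansion zero r = sym (trans (sumL-allShapes (λ s → γ 𝟘 s * ⟦ allows s r ⟧))
    (trans (+-cong (*-identityˡ _) (+-cong (zeroˡ _) (zeroˡ _))) (trans (+-congˡ (+-identityˡ 0#)) (+-identityʳ _))))
  γ-expansion (suc zero) r = sym (trans (sumL-allShapes (λ s → γ 𝟙 s * ⟦ allows s r ⟧))
    (trans (+-cong (-1*x≈-x _) (+-cong (*-identityˡ _) (zeroˡ _))) (trans (+-congˡ (+-identityʳ _)) (by-rel r))))
    where
    by-rel : ∀ r → - ⟦ allows diag r ⟧ + ⟦ allows block r ⟧ ≈ ⟦ does (r ≟F 𝟙) ⟧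
    by-rel zero             = -‿inverseˡ 1#
    by-rel (suc zero)       = trans (+-congʳ -0#≈0#) (+-identityˡ _)
    by-rel (suc (suc zero)) = trans (+-congʳ -0#≈0#) (+-identityˡ _)
  γ-expansion (suc (suc zero)) r = sym (trans (sumL-allShapes (λ s → γ 𝟚 s * ⟦ allows s r ⟧))
    (trans (+-cong (zeroˡ _) (+-cong (-1*x≈-x _) (*-identityˡ _))) (trans (+-identityˡ _) (by-rel r))))
    where
    by-rel : ∀ r → - ⟦ allows block r ⟧ + 1# ≈ ⟦ does (r ≟F 𝟚) ⟧
    by-rel zero             = -‿inverseˡ 1#
    by-rel (suc zero)       = -‿inverseˡ 1#
    by-rel (suc (suc zero)) = trans (+-congʳ -0#≈0#) (+-identityˡ _)

module Coordinate {c ℓ} (F : Field c ℓ) {l m : ℕ} (x₀ : Fin l × Fin m) where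
  open Field F hiding (zero)
  open FiniteSums commutativeRing
  open FieldFacts F
  open Relations {l} {m}
  open import Relation.Binary.Reasoning.Setoid setoid

  b₀ : Fin l
  b₀ = proj₁ x₀

  q₀ : Fin m
  q₀ = proj₂ x₀

  points : List Point
  points = cartesianProduct (allFinL l) (allFinL m)

  ∑U : (Point → Carrier) → Carrier
  ∑U h = sumL h points

  ∑U-cong : ∀ {h h′ : Point → Carrier} → (∀ u → h u ≈ h′ u) → ∑U h ≈ ∑U h′
  ∑U-cong = sumL-cong points

  ∑U-split : ∀ h → ∑U h ≈ sum (λ b → sum (λ q → h (b , q)))
  ∑U-split h = trans (sumL-cartesianProduct h (allFinL l) (allFinL m))
                     (trans (sumL-cong (allFinL l) (λ b → sumL-allFin m _)) (sumL-allFin l _))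

  idU : Point → Point → Carrier
  idU u v = ⟦ does (rel u v ≟F 𝟘) ⟧

  idU-δδ : ∀ u v → idU u v ≈ δ (proj₁ u) (proj₁ v) * δ (proj₂ u) (proj₂ v)
  idU-δδ u v rewrite rel≡relBits u v with does (proj₁ u ≟F proj₁ v) | does (proj₂ u ≟F proj₂ v)
  ... | true  | true  = sym (*-identityˡ _)
  ... | true  | false = sym (zeroʳ _)
  ... | false | _     = sym (zeroˡ _)

  idU-sym : ∀ u v → idU u v ≈ idU v u
  idU-sym u v = reflexive (≡.cong (λ r → ⟦ does (r ≟F 𝟘) ⟧) (rel-sym u v))

  ∑U-idUˡ : ∀ u (h : Point → Carrier) → ∑U (λ w → idU u w * h w) ≈ h u
  ∑U-idUˡ (b , q) h = begin
    ∑U (λ w → idU (b , q) w * h w)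
      ≈⟨ ∑U-split _ ⟩
    sum (λ b′ → sum (λ q′ → idU (b , q) (b′ , q′) * h (b′ , q′)))
      ≈⟨ sum-cong-≋ {l} (λ b′ → sum-cong-≋ {m} (λ q′ →
           trans (*-congʳ (idU-δδ (b , q) (b′ , q′))) (*-assoc _ _ _))) ⟩
    sum (λ b′ → sum (λ q′ → δ b b′ * (δ q q′ * h (b′ , q′))))
      ≈⟨ sum-cong-≋ {l} (λ b′ → sym (*-distribˡ-sum {m} (δ b b′) _)) ⟩
    sum (λ b′ → δ b b′ * sum (λ q′ → δ q q′ * h (b′ , q′)))
      ≈⟨ ∑-δ b _ ⟩
    sum (λ q′ → δ q q′ * h (b , q′))
      ≈⟨ ∑-δ q _ ⟩
    h (b , q) ∎

  ∑U-idUʳ : ∀ u (h : Point → Carrier) → ∑U (λ w → h w * idU w u) ≈ h u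
  ∑U-idUʳ u h = trans (∑U-cong (λ w → trans (*-comm _ _) (*-congʳ (idU-sym w u)))) (∑U-idUˡ u h)

  χ : Fin 3 → Point → Carrier
  χ G u = ⟦ does (rel x₀ u ≟F G) ⟧

  χ-at : ∀ {G u r} → rel x₀ u ≡ r → χ G u ≈ ⟦ does (r ≟F G) ⟧
  χ-at {G} x₀ru = reflexive (≡.cong (λ r → ⟦ does (r ≟F G) ⟧) x₀ru)

  χ-∈ : ∀ {G u} → rel x₀ u ≡ G → χ G u ≈ 1#
  χ-∈ {G} {u} x₀Gu = reflexive (≡.cong ⟦_⟧ (dec-true (rel x₀ u ≟F G) x₀Gu))

  χ-∉ : ∀ {G u} → rel x₀ u ≢ G → χ G u ≈ 0#
  χ-∉ {G} {u} ¬x₀Gu = reflexive (≡.cong ⟦_⟧ (dec-false (rel x₀ u ≟F G) ¬x₀Gu))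

  χ𝟚-inBlock : ∀ q → χ 𝟚 (b₀ , q) ≈ 0#
  χ𝟚-inBlock q = χ-∉ (λ x₀R₂u → rel≡𝟚⇒ x₀ (b₀ , q) x₀R₂u ≡.refl)

  allowed : Shape → Point → Point → Carrier
  allowed s u v = ⟦ allows s (rel u v) ⟧

  allowed-refl : ∀ s u → allowed s u u ≈ 1#
  allowed-refl s u = reflexive (≡.cong ⟦_⟧ (≡.trans (≡.cong (allows s) (rel-refl u)) (allows-𝟘 s)))

  allowed-block : ∀ u v → allowed block u v ≈ δ (proj₁ u) (proj₁ v)
  allowed-block u v rewrite rel≡relBits u v with does (proj₁ u ≟F proj₁ v) | does (proj₂ u ≟F proj₂ v)
  ... | true  | true  = refl
  ... | true  | false = refl
  ... | false | _     = refl

  allowed-sameBlock : ∀ s u v → s ≢ diag → proj₁ u ≡ proj₁ v → allowed s u v ≈ 1#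
  allowed-sameBlock diag  u v s≢diag _     = contradiction ≡.refl s≢diag
  allowed-sameBlock block u v _      bu≡bv = trans (allowed-block u v) (reflexive (≡.cong ⟦_⟧ (dec-true (_ ≟F _) bu≡bv)))
  allowed-sameBlock full  u v _      _     = refl

  shapeMatrix : Fin 3 → Shape → Point → Point → Carrier
  shapeMatrix G s u v = (χ G u * χ G v) * allowed s u v

  -- κ G s counts the w ∈ R_G(x₀) that s allows next to a fixed u ∈ R_G(x₀) (see restricted-sum)
  κ : Fin 3 → Shape → ℕ
  κ G                diag  = 1
  κ zero             block = 1
  κ zero             full  = 1
  κ (suc zero)       block = m ∸ 1
  κ (suc zero)       full  = m ∸ 1
  κ (suc (suc zero)) block = m
  κ (suc (suc zero)) full  = (l ∸ 1) *ℕ m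

  κ-∣-⊔ˡ : ∀ G s t → κ G s ∣ κ G (s ⊔ˢ t)
  κ-∣-⊔ˡ G                diag  t     = 1∣ _
  κ-∣-⊔ˡ G                full  t     = ∣-refl
  κ-∣-⊔ˡ G                block diag  = ∣-refl
  κ-∣-⊔ˡ G                block block = ∣-refl
  κ-∣-⊔ˡ zero             block full  = ∣-refl
  κ-∣-⊔ˡ (suc zero)       block full  = ∣-refl
  κ-∣-⊔ˡ (suc (suc zero)) block full  = n∣m*n (l ∸ 1)

  κ-∣-⊔ʳ : ∀ G s t → κ G t ∣ κ G (s ⊔ˢ t)
  κ-∣-⊔ʳ G s t = ≡.subst (λ u → κ G t ∣ κ G u) (⊔ˢ-comm t s) (κ-∣-⊔ˡ G t s)

  κ-cases : ∀ G s → κ G s ≡ 1 ⊎ (G ≡ 𝟙 × κ G s ≡ m ∸ 1) ⊎ (G ≡ 𝟚 × κ G s ∣ (l ∸ 1) *ℕ m)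
  κ-cases G                diag  = inj₁ ≡.refl
  κ-cases zero             block = inj₁ ≡.refl
  κ-cases zero             full  = inj₁ ≡.refl
  κ-cases (suc zero)       block = inj₂ (inj₁ (≡.refl , ≡.refl))
  κ-cases (suc zero)       full  = inj₂ (inj₁ (≡.refl , ≡.refl))
  κ-cases (suc (suc zero)) block = inj₂ (inj₂ (≡.refl , n∣m*n (l ∸ 1)))
  κ-cases (suc (suc zero)) full  = inj₂ (inj₂ (≡.refl , ∣-refl))

  size-R₁ : ∑U (χ 𝟙) ≈ ι F (m ∸ 1)
  size-R₁ = begin
    ∑U (χ 𝟙)                                        ≈⟨ ∑U-split (χ 𝟙) ⟩
    sum (λ b → sum (λ q → χ 𝟙 (b , q)))              ≈⟨ sum-except b₀ _ outside ⟩
    sum (λ q → χ 𝟙 (b₀ , q)) + ι F (l ∸ 1) * 0#      ≈⟨ trans (+-congˡ (zeroʳ _)) (+-identityʳ _) ⟩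
    sum (λ q → χ 𝟙 (b₀ , q))                         ≈⟨ sum-except q₀ (λ q → χ 𝟙 (b₀ , q)) inside ⟩
    χ 𝟙 x₀ + ι F (m ∸ 1) * 1#                        ≈⟨ +-cong (χ-at (rel-refl x₀)) (*-identityʳ _) ⟩
    0# + ι F (m ∸ 1)                                 ≈⟨ +-identityˡ _ ⟩
    ι F (m ∸ 1)                                      ∎
    where
    outside : ∀ b → b₀ ≢ b → sum (λ q → χ 𝟙 (b , q)) ≈ 0#
    outside b b₀≢b = sum-zero (λ q → χ 𝟙 (b , q)) (λ q → χ-at (rel-otherBlock q₀ q b₀≢b))
    inside : ∀ q → q₀ ≢ q → χ 𝟙 (b₀ , q) ≈ 1#
    inside q q₀≢q = χ-∈ (rel-sameBlock b₀ q₀≢q)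

  χ𝟚-otherBlock : ∀ {b} → b₀ ≢ b → ∀ q → χ 𝟚 (b , q) ≈ 1#
  χ𝟚-otherBlock b₀≢b q = χ-at (rel-otherBlock q₀ q b₀≢b)

  sum-ones : ∀ k → sum {k} (λ _ → 1#) ≈ ι F k
  sum-ones k = trans (sum-const k 1#) (*-identityʳ _)

  size-R₂ : ∑U (χ 𝟚) ≈ ι F ((l ∸ 1) *ℕ m)
  size-R₂ = begin
    ∑U (χ 𝟚)                                             ≈⟨ ∑U-split (χ 𝟚) ⟩
    sum (λ b → sum (λ q → χ 𝟚 (b , q)))                   ≈⟨ sum-except b₀ _ outside ⟩
    sum (λ q → χ 𝟚 (b₀ , q)) + ι F (l ∸ 1) * ι F m        ≈⟨ +-congʳ (sum-zero (λ q → χ 𝟚 (b₀ , q)) χ𝟚-inBlock) ⟩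
    0# + ι F (l ∸ 1) * ι F m                              ≈⟨ +-identityˡ _ ⟩
    ι F (l ∸ 1) * ι F m                                   ≈⟨ ι-* (l ∸ 1) m ⟨
    ι F ((l ∸ 1) *ℕ m)                                    ∎
    where
    outside : ∀ b → b₀ ≢ b → sum (λ q → χ 𝟚 (b , q)) ≈ ι F m
    outside b b₀≢b = trans (sum-cong-≋ (χ𝟚-otherBlock b₀≢b)) (sum-ones m)

  size-R₂∩block : ∀ {b} → b₀ ≢ b → ∑U (λ w → χ 𝟚 w * δ b (proj₁ w)) ≈ ι F m
  size-R₂∩block {b} b₀≢b = begin
    ∑U (λ w → χ 𝟚 w * δ b (proj₁ w))                      ≈⟨ ∑U-split _ ⟩
    sum (λ b′ → sum (λ q → χ 𝟚 (b′ , q) * δ b b′))         ≈⟨ sum-except b _ outside ⟩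
    sum (λ q → χ 𝟚 (b , q) * δ b b) + ι F (l ∸ 1) * 0#     ≈⟨ trans (+-congˡ (zeroʳ _)) (+-identityʳ _) ⟩
    sum (λ q → χ 𝟚 (b , q) * δ b b)
      ≈⟨ sum-cong-≋ (λ q → trans (*-cong (χ𝟚-otherBlock b₀≢b q) (δ-refl b)) (*-identityˡ 1#)) ⟩
    sum {m} (λ _ → 1#)                                     ≈⟨ sum-ones m ⟩
    ι F m                                                  ∎
    where
    outside : ∀ b′ → b ≢ b′ → sum (λ q → χ 𝟚 (b′ , q) * δ b b′) ≈ 0#
    outside b′ b≢b′ = sum-zero (λ q → χ 𝟚 (b′ , q) * δ b b′) (λ q → trans (*-congˡ (δ-≢ b≢b′)) (zeroʳ _))

  restricted-sum-diagˡ : ∀ G t u v → rel x₀ u ≡ G →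
    ∑U (λ w → χ G w * (allowed diag u w * allowed t w v)) ≈ ι F 1 * allowed t u v
  restricted-sum-diagˡ G t u v x₀Gu = begin
    ∑U (λ w → χ G w * (idU u w * allowed t w v))  ≈⟨ ∑U-cong (λ w → x*yz≈y*xz (χ G w) _ _) ⟩
    ∑U (λ w → idU u w * (χ G w * allowed t w v))  ≈⟨ ∑U-idUˡ u _ ⟩
    χ G u * allowed t u v                         ≈⟨ *-congʳ (trans (χ-∈ x₀Gu) (sym ι-1)) ⟩
    ι F 1 * allowed t u v                         ∎

  restricted-sum-diagʳ : ∀ G s u v → rel x₀ v ≡ G →
    ∑U (λ w → χ G w * (allowed s u w * allowed diag w v)) ≈ ι F 1 * allowed s u v
  restricted-sum-diagʳ G s u v x₀Gv = begin
    ∑U (λ w → χ G w * (allowed s u w * idU w v))  ≈⟨ ∑U-cong (λ w → sym (*-assoc _ _ _)) ⟩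
    ∑U (λ w → (χ G w * allowed s u w) * idU w v)  ≈⟨ ∑U-idUʳ v _ ⟩
    χ G v * allowed s u v                         ≈⟨ *-congʳ (trans (χ-∈ x₀Gv) (sym ι-1)) ⟩
    ι F 1 * allowed s u v                         ∎

  restricted-sum-R₀ : ∀ s t u v → rel x₀ u ≡ 𝟘 → rel x₀ v ≡ 𝟘 →
    ∑U (λ w → χ 𝟘 w * (allowed s u w * allowed t w v)) ≈ ι F 1 * allowed (s ⊔ˢ t) u v
  restricted-sum-R₀ s t u v x₀R₀u x₀R₀v with rel≡𝟘⇒≡ x₀ u x₀R₀u | rel≡𝟘⇒≡ x₀ v x₀R₀v
  ... | ≡.refl | ≡.refl = begin
    ∑U (λ w → idU x₀ w * (allowed s x₀ w * allowed t w x₀))  ≈⟨ ∑U-idUˡ x₀ _ ⟩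
    allowed s x₀ x₀ * allowed t x₀ x₀                       ≈⟨ trans (*-cong (allowed-refl s x₀) (allowed-refl t x₀)) (*-identityˡ 1#) ⟩
    1#                                                      ≈⟨ trans (*-cong ι-1 (allowed-refl (s ⊔ˢ t) x₀)) (*-identityˡ 1#) ⟨
    ι F 1 * allowed (s ⊔ˢ t) x₀ x₀                          ∎

  restricted-sum-R₁ : ∀ s t u v → s ≢ diag → t ≢ diag → s ⊔ˢ t ≢ diag → rel x₀ u ≡ 𝟙 → rel x₀ v ≡ 𝟙 →
    ∑U (λ w → χ 𝟙 w * (allowed s u w * allowed t w v)) ≈ ι F (m ∸ 1) * allowed (s ⊔ˢ t) u v
  restricted-sum-R₁ s t u v s≢diag t≢diag s⊔t≢diag x₀R₁u x₀R₁v = begin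
    ∑U (λ w → χ 𝟙 w * (allowed s u w * allowed t w v))  ≈⟨ ∑U-cong only-χ ⟩
    ∑U (χ 𝟙)                                            ≈⟨ size-R₁ ⟩
    ι F (m ∸ 1)                                         ≈⟨ *-identityʳ _ ⟨
    ι F (m ∸ 1) * 1#                                    ≈⟨ *-congˡ (allowed-sameBlock _ u v s⊔t≢diag (≡.trans (≡.sym (b₀≡ x₀R₁u)) (b₀≡ x₀R₁v))) ⟨
    ι F (m ∸ 1) * allowed (s ⊔ˢ t) u v                  ∎
    where
    b₀≡ : ∀ {w} → rel x₀ w ≡ 𝟙 → b₀ ≡ proj₁ w
    b₀≡ x₀R₁w = proj₁ (rel≡𝟙⇒ x₀ _ x₀R₁w)
    only-χ : ∀ w → χ 𝟙 w * (allowed s u w * allowed t w v) ≈ χ 𝟙 w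
    only-χ w with rel x₀ w ≟F 𝟙
    ... | no _      = zeroˡ _
    ... | yes x₀R₁w = trans (*-congˡ (trans (*-cong
            (allowed-sameBlock s u w s≢diag (≡.trans (≡.sym (b₀≡ x₀R₁u)) (b₀≡ x₀R₁w)))
            (allowed-sameBlock t w v t≢diag (≡.trans (≡.sym (b₀≡ x₀R₁w)) (b₀≡ x₀R₁v))))
            (*-identityˡ 1#))) (*-identityʳ _)

  restricted-sum-R₂ : ∀ s t u v → s ≢ diag → t ≢ diag → rel x₀ u ≡ 𝟚 → rel x₀ v ≡ 𝟚 →
    ∑U (λ w → χ 𝟚 w * (allowed s u w * allowed t w v)) ≈ ι F (κ 𝟚 (s ⊓ˢ t)) * allowed (s ⊔ˢ t) u v
  restricted-sum-R₂ diag _     u v s≢diag _ _ _ = contradiction ≡.refl s≢diag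
  restricted-sum-R₂ _    diag  u v _ t≢diag _ _ = contradiction ≡.refl t≢diag
  restricted-sum-R₂ block block u v _ _ x₀R₂u x₀R₂v = begin
    ∑U (λ w → χ 𝟚 w * (allowed block u w * allowed block w v))
      ≈⟨ ∑U-cong (λ w → *-congˡ (trans (*-cong (allowed-block u w) (allowed-block w v))
                                       (δ-transport (proj₁ u) (proj₁ w) (proj₁ v)))) ⟩
    ∑U (λ w → χ 𝟚 w * (δ (proj₁ u) (proj₁ w) * δ (proj₁ u) (proj₁ v)))
      ≈⟨ ∑U-cong (λ w → x*yz≈z*xy (χ 𝟚 w) _ _) ⟩
    ∑U (λ w → δ (proj₁ u) (proj₁ v) * (χ 𝟚 w * δ (proj₁ u) (proj₁ w)))
      ≈⟨ sumL-*ˡ _ _ points ⟩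
    δ (proj₁ u) (proj₁ v) * ∑U (λ w → χ 𝟚 w * δ (proj₁ u) (proj₁ w))
      ≈⟨ *-congˡ (size-R₂∩block (rel≡𝟚⇒ x₀ u x₀R₂u)) ⟩
    δ (proj₁ u) (proj₁ v) * ι F m
      ≈⟨ trans (*-comm (δ (proj₁ u) (proj₁ v)) (ι F m)) (*-congˡ (sym (allowed-block u v))) ⟩
    ι F m * allowed block u v ∎
  restricted-sum-R₂ block full u v _ _ x₀R₂u x₀R₂v = begin
    ∑U (λ w → χ 𝟚 w * (allowed block u w * 1#))   ≈⟨ ∑U-cong (λ w → *-congˡ (trans (*-identityʳ _) (allowed-block u w))) ⟩
    ∑U (λ w → χ 𝟚 w * δ (proj₁ u) (proj₁ w))      ≈⟨ size-R₂∩block (rel≡𝟚⇒ x₀ u x₀R₂u) ⟩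
    ι F m                                         ≈⟨ *-identityʳ _ ⟨
    ι F m * 1#                                    ∎
  restricted-sum-R₂ full block u v _ _ x₀R₂u x₀R₂v = begin
    ∑U (λ w → χ 𝟚 w * (1# * allowed block w v))
      ≈⟨ ∑U-cong (λ w → *-congˡ (trans (*-identityˡ _) (trans (allowed-block w v) (δ-sym (proj₁ w) (proj₁ v))))) ⟩
    ∑U (λ w → χ 𝟚 w * δ (proj₁ v) (proj₁ w))      ≈⟨ size-R₂∩block (rel≡𝟚⇒ x₀ v x₀R₂v) ⟩
    ι F m                                         ≈⟨ *-identityʳ _ ⟨
    ι F m * 1#                                    ∎
  restricted-sum-R₂ full full u v _ _ _ _ = begin
    ∑U (λ w → χ 𝟚 w * (1# * 1#))                  ≈⟨ ∑U-cong (λ w → trans (*-congˡ (*-identityˡ 1#)) (*-identityʳ _)) ⟩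
    ∑U (χ 𝟚)                                      ≈⟨ size-R₂ ⟩
    ι F ((l ∸ 1) *ℕ m)                            ≈⟨ *-identityʳ _ ⟨
    ι F ((l ∸ 1) *ℕ m) * 1#                       ∎

  restricted-sum : ∀ G s t u v → rel x₀ u ≡ G → rel x₀ v ≡ G →
    ∑U (λ w → χ G w * (allowed s u w * allowed t w v)) ≈ ι F (κ G (s ⊓ˢ t)) * allowed (s ⊔ˢ t) u v
  restricted-sum G                diag  t     u v x₀Gu x₀Gv = restricted-sum-diagˡ G t u v x₀Gu
  restricted-sum G                block diag  u v x₀Gu x₀Gv = restricted-sum-diagʳ G block u v x₀Gv
  restricted-sum G                full  diag  u v x₀Gu x₀Gv = restricted-sum-diagʳ G full u v x₀Gv
  restricted-sum zero             block block u v x₀Gu x₀Gv = restricted-sum-R₀ block block u v x₀Gu x₀Gv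
  restricted-sum zero             block full  u v x₀Gu x₀Gv = restricted-sum-R₀ block full u v x₀Gu x₀Gv
  restricted-sum zero             full  block u v x₀Gu x₀Gv = restricted-sum-R₀ full block u v x₀Gu x₀Gv
  restricted-sum zero             full  full  u v x₀Gu x₀Gv = restricted-sum-R₀ full full u v x₀Gu x₀Gv
  restricted-sum (suc zero)       block block u v x₀Gu x₀Gv = restricted-sum-R₁ block block u v (λ ()) (λ ()) (λ ()) x₀Gu x₀Gv
  restricted-sum (suc zero)       block full  u v x₀Gu x₀Gv = restricted-sum-R₁ block full u v (λ ()) (λ ()) (λ ()) x₀Gu x₀Gv
  restricted-sum (suc zero)       full  block u v x₀Gu x₀Gv = restricted-sum-R₁ full block u v (λ ()) (λ ()) (λ ()) x₀Gu x₀Gv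
  restricted-sum (suc zero)       full  full  u v x₀Gu x₀Gv = restricted-sum-R₁ full full u v (λ ()) (λ ()) (λ ()) x₀Gu x₀Gv
  restricted-sum (suc (suc zero)) block block u v x₀Gu x₀Gv = restricted-sum-R₂ block block u v (λ ()) (λ ()) x₀Gu x₀Gv
  restricted-sum (suc (suc zero)) block full  u v x₀Gu x₀Gv = restricted-sum-R₂ block full u v (λ ()) (λ ()) x₀Gu x₀Gv
  restricted-sum (suc (suc zero)) full  block u v x₀Gu x₀Gv = restricted-sum-R₂ full block u v (λ ()) (λ ()) x₀Gu x₀Gv
  restricted-sum (suc (suc zero)) full  full  u v x₀Gu x₀Gv = restricted-sum-R₂ full full u v (λ ()) (λ ()) x₀Gu x₀Gv

  shapeMatrix-mul : ∀ G s t u v →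
    ∑U (λ w → shapeMatrix G s u w * shapeMatrix G t w v) ≈ ι F (κ G (s ⊓ˢ t)) * shapeMatrix G (s ⊔ˢ t) u v
  shapeMatrix-mul G s t u v = begin
    ∑U (λ w → shapeMatrix G s u w * shapeMatrix G t w v)
      ≈⟨ ∑U-cong (λ w → regroup (χ G u) (χ G w) (allowed s u w) (χ G v) (allowed t w v)) ⟩
    ∑U (λ w → (χ G u * χ G v) * ((χ G w * χ G w) * (allowed s u w * allowed t w v)))
      ≈⟨ ∑U-cong (λ w → *-congˡ (*-congʳ (⟦⟧-idem _))) ⟩
    ∑U (λ w → (χ G u * χ G v) * (χ G w * (allowed s u w * allowed t w v)))
      ≈⟨ sumL-*ˡ _ _ points ⟩
    (χ G u * χ G v) * ∑U (λ w → χ G w * (allowed s u w * allowed t w v))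
      ≈⟨ on-R_G (rel x₀ u ≟F G) (rel x₀ v ≟F G) ⟩
    ι F (κ G (s ⊓ˢ t)) * shapeMatrix G (s ⊔ˢ t) u v ∎
    where
    open Algebra.Solver.CommutativeMonoid *-commutativeMonoid using (solve; _⊕_; _⊜_)
    regroup : ∀ a b d e f → ((a * b) * d) * ((b * e) * f) ≈ (a * e) * ((b * b) * (d * f))
    regroup = solve 5 (λ a b d e f → ((a ⊕ b) ⊕ d) ⊕ ((b ⊕ e) ⊕ f) ⊜ (a ⊕ e) ⊕ ((b ⊕ b) ⊕ (d ⊕ f))) refl
    K = ι F (κ G (s ⊓ˢ t))
    vanishing : ∀ {S} → χ G u * χ G v ≈ 0# → (χ G u * χ G v) * S ≈ K * shapeMatrix G (s ⊔ˢ t) u v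
    vanishing χχ≈0 = trans (trans (*-congʳ χχ≈0) (zeroˡ _))
                           (sym (trans (*-congˡ (trans (*-congʳ χχ≈0) (zeroˡ _))) (zeroʳ _)))
    on-R_G : Dec (rel x₀ u ≡ G) → Dec (rel x₀ v ≡ G) →
             (χ G u * χ G v) * ∑U (λ w → χ G w * (allowed s u w * allowed t w v)) ≈ K * shapeMatrix G (s ⊔ˢ t) u v
    on-R_G (yes x₀Gu) (yes x₀Gv) =
      trans (*-congˡ (restricted-sum G s t u v x₀Gu x₀Gv))
            (x*yz≈y*xz (χ G u * χ G v) K (allowed (s ⊔ˢ t) u v))
    on-R_G (no ¬x₀Gu) _         = vanishing (trans (*-congʳ (χ-∉ ¬x₀Gu)) (zeroˡ _))
    on-R_G (yes _)    (no ¬x₀Gv) = vanishing (trans (*-congˡ (χ-∉ ¬x₀Gv)) (zeroʳ _))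

  record Symmetry : Set (c ⊔ ℓ) where
    field
      φ     : Point → Point
      φ-rel : ∀ u v → rel (φ u) (φ v) ≡ rel u v
      φ-x₀  : φ x₀ ≡ x₀
      ∑U-φ  : ∀ h → ∑U (h ∘ φ) ≈ ∑U h

    φ-relx₀ : ∀ u → rel x₀ (φ u) ≡ rel x₀ u
    φ-relx₀ u = ≡.trans (≡.cong (λ z → rel z (φ u)) (≡.sym φ-x₀)) (φ-rel x₀ u)

  open Symmetry public

  _∘ˢ_ : Symmetry → Symmetry → Symmetry
  α ∘ˢ β = record
    { φ     = φ α ∘ φ β
    ; φ-rel = λ u v → ≡.trans (φ-rel α (φ β u) (φ β v)) (φ-rel β u v)
    ; φ-x₀  = ≡.trans (≡.cong (φ α) (φ-x₀ β)) (φ-x₀ α)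
    ; ∑U-φ  = λ h → trans (∑U-φ β (h ∘ φ α)) (∑U-φ α h)
    }

  permuteBlocks : (π : Permutation′ l) → π ⟨$⟩ʳ b₀ ≡ b₀ → Symmetry
  permuteBlocks π πb₀≡b₀ = record
    { φ     = λ u → π ⟨$⟩ʳ proj₁ u , proj₂ u
    ; φ-rel = λ u v → ≡.trans (rel≡relBits _ _)
                        (≡.trans (≡.cong (λ β → relBits β (does (proj₂ u ≟F proj₂ v)))
                                         (does-≟-injective _ (permutation-injective π) (proj₁ u) (proj₁ v)))
                                 (≡.sym (rel≡relBits u v)))
    ; φ-x₀  = ≡.cong (_, q₀) πb₀≡b₀
    ; ∑U-φ  = λ h → trans (∑U-split _) (trans (sym (sum-permute (λ b → sum (λ q → h (b , q))) π)) (sym (∑U-split h)))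
    }

  permutePositions : (τ : Fin l → Permutation′ m) → τ b₀ ⟨$⟩ʳ q₀ ≡ q₀ → Symmetry
  permutePositions τ τq₀≡q₀ = record
    { φ     = φ′
    ; φ-rel = φ′-rel
    ; φ-x₀  = ≡.cong (b₀ ,_) τq₀≡q₀
    ; ∑U-φ  = λ h → trans (∑U-split _)
                      (trans (sum-cong-≋ {l} (λ b → sym (sum-permute (λ q → h (b , q)) (τ b)))) (sym (∑U-split h)))
    }
    where
    φ′ : Point → Point
    φ′ (b , q) = b , τ b ⟨$⟩ʳ q
    φ′-rel : ∀ u v → rel (φ′ u) (φ′ v) ≡ rel u v
    φ′-rel (b , q) (b′ , q′) = by-block (b ≟F b′)
      where
      by-block : ∀ {b′ q′} → Dec (b ≡ b′) → rel (φ′ (b , q)) (φ′ (b′ , q′)) ≡ rel (b , q) (b′ , q′)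
      by-block (no b≢b′)  = ≡.trans (rel-otherBlock _ _ b≢b′) (≡.sym (rel-otherBlock _ _ b≢b′))
      by-block {q′ = q′} (yes ≡.refl) =
        ≡.trans (rel≡relBits _ _)
                (≡.trans (≡.cong (relBits _) (does-≟-injective _ (permutation-injective (τ b)) q q′))
                         (≡.sym (rel≡relBits _ _)))

  moveBlock : ∀ u u′ w → rel x₀ u′ ≡ rel x₀ u → rel w u′ ≡ rel w u →
              Σ Symmetry λ α → proj₁ (φ α u′) ≡ proj₁ u × φ α w ≡ w
  moveBlock u u′ w x₀-same w-same = α , transpose-hits (proj₁ u′) (proj₁ u) , ≡.cong (_, proj₂ w) (fixes w w-same)
    where
    fixes : ∀ z → rel z u′ ≡ rel z u → Perm.transpose (proj₁ u′) (proj₁ u) ⟨$⟩ʳ proj₁ z ≡ proj₁ z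
    fixes z z-same = transpose-fixes _ _ _ (does-≟-transfer (sameBlock-respects-rel z u u′ z-same))
                                           (does-≟-transfer (≡.sym (sameBlock-respects-rel z u u′ z-same)))
    α = permuteBlocks (Perm.transpose (proj₁ u′) (proj₁ u)) (fixes x₀ x₀-same)

  moveWithinBlock : ∀ u u′ w → proj₁ u′ ≡ proj₁ u → rel x₀ u′ ≡ rel x₀ u → rel w u′ ≡ rel w u →
                    Σ Symmetry λ α → φ α u′ ≡ u × φ α w ≡ w
  moveWithinBlock (b , q) (b , q′) w ≡.refl x₀-same w-same = α , hits , fixes w w-same
    where
    swapIn : ∀ {b′} → Dec (b′ ≡ b) → Permutation′ m
    swapIn (yes _) = Perm.transpose q′ q
    swapIn (no _)  = Perm.id
    τ : Fin l → Permutation′ m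
    τ b′ = swapIn (b′ ≟F b)
    fixes : ∀ z → rel z (b , q′) ≡ rel z (b , q) → (proj₁ z , τ (proj₁ z) ⟨$⟩ʳ proj₂ z) ≡ z
    fixes z z-same = by-block (proj₁ z ≟F b)
      where
      by-block : (d : Dec (proj₁ z ≡ b)) → (proj₁ z , swapIn d ⟨$⟩ʳ proj₂ z) ≡ z
      by-block (no _)      = ≡.refl
      by-block (yes z∈b) = ≡.cong (proj₁ z ,_) (transpose-fixes _ _ _
        (does-≟-transfer (samePosition-respects-rel z (b , q) (b , q′) z∈b z∈b z-same))
        (does-≟-transfer (≡.sym (samePosition-respects-rel z (b , q) (b , q′) z∈b z∈b z-same))))
    α = permutePositions τ (≡.cong proj₂ (fixes x₀ x₀-same))
    hits : (b , τ b ⟨$⟩ʳ q′) ≡ (b , q)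
    hits with b ≟F b
    ... | yes _  = ≡.cong (b ,_) (transpose-hits q′ q)
    ... | no b≢b = contradiction ≡.refl b≢b

  move : ∀ u u′ w → rel x₀ u′ ≡ rel x₀ u → rel w u′ ≡ rel w u → Σ Symmetry λ α → φ α u′ ≡ u × φ α w ≡ w
  move u u′ w x₀-same w-same with moveBlock u u′ w x₀-same w-same
  ... | α , αu′~u , αw≡w with moveWithinBlock u (φ α u′) w αu′~u (≡.trans (φ-relx₀ α u′) x₀-same) w-same′
    where w-same′ = ≡.trans (≡.cong (λ z → rel z (φ α u′)) (≡.sym αw≡w)) (≡.trans (φ-rel α w u′) w-same)
  ... | β , βαu′≡u , βw≡w = β ∘ˢ α , βαu′≡u , ≡.trans (≡.cong (φ β) αw≡w) βw≡w

  transitive : ∀ u v u′ v′ → rel x₀ u′ ≡ rel x₀ u → rel x₀ v′ ≡ rel x₀ v → rel u′ v′ ≡ rel u v →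
               Σ Symmetry λ α → φ α u′ ≡ u × φ α v′ ≡ v
  transitive u v u′ v′ x₀u-same x₀v-same uv-same with move u u′ x₀ x₀u-same x₀u-same
  ... | α , αu′≡u , _ with move v (φ α v′) u (≡.trans (φ-relx₀ α v′) x₀v-same) u-same
    where u-same = ≡.trans (≡.cong (λ z → rel z (φ α v′)) (≡.sym αu′≡u)) (≡.trans (φ-rel α u′ v′) uv-same)
  ... | β , βαv′≡v , βu≡u = β ∘ˢ α , ≡.trans (≡.cong (φ β) αu′≡u) βu≡u , βαv′≡v

  Admissible : Fin 3 → Fin 3 → Set
  Admissible zero             r = r ≡ 𝟘
  Admissible (suc zero)       r = r ≢ 𝟚 × (¬ (2 < m) → r ≡ 𝟘)
  Admissible (suc (suc zero)) r = ¬ (2 < l) → r ≢ 𝟚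

  admissible : ∀ G u v → rel x₀ u ≡ G → rel x₀ v ≡ G → Admissible G (rel u v)
  admissible zero u v x₀R₀u x₀R₀v with rel≡𝟘⇒≡ x₀ u x₀R₀u | rel≡𝟘⇒≡ x₀ v x₀R₀v
  ... | ≡.refl | ≡.refl = rel-refl x₀
  admissible (suc zero) u v x₀R₁u x₀R₁v = (λ uR₂v → rel≡𝟚⇒ u v uR₂v same-block) , small-block
    where
    same-block : proj₁ u ≡ proj₁ v
    same-block = ≡.trans (≡.sym (proj₁ (rel≡𝟙⇒ x₀ u x₀R₁u))) (proj₁ (rel≡𝟙⇒ x₀ v x₀R₁v))
    small-block : ¬ (2 < m) → rel u v ≡ 𝟘
    small-block m≯2 = ≡.subst (λ z → rel u z ≡ 𝟘) (≡.cong₂ _,_ same-block same-position) (rel-refl u)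
      where
      same-position = Fin≤2-≢⇒≡ m≯2 (proj₂ u) (proj₂ v) q₀
                        (proj₂ (rel≡𝟙⇒ x₀ u x₀R₁u) ∘ ≡.sym) (proj₂ (rel≡𝟙⇒ x₀ v x₀R₁v) ∘ ≡.sym)
  admissible (suc (suc zero)) u v x₀R₂u x₀R₂v l≯2 uR₂v = rel≡𝟚⇒ u v uR₂v
    (Fin≤2-≢⇒≡ l≯2 (proj₁ u) (proj₁ v) b₀ (rel≡𝟚⇒ x₀ u x₀R₂u ∘ ≡.sym) (rel≡𝟚⇒ x₀ v x₀R₂v ∘ ≡.sym))

  -- one conjunct of Defs.CondB g g τ a, with A₁ A₂ A₃ standing for i ∈ J₁, i ∈ J₂, i ∈ J₃
  LocalCond : Set → Set → Set → Fin 3 → Fin 3 → Set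
  LocalCond A₁ A₂ A₃ G r = (r ≡ 𝟙 → G ≡ 𝟙 → G ≡ 𝟙 → 2 < m → A₁)
                         × (r ≡ 𝟚 → G ≡ 𝟚 → G ≡ 𝟚 → 2 < l → A₂)
                         × (r ≡ 𝟙 → G ≡ 𝟚 → G ≡ 𝟚 → A₃)

  localCond? : ∀ {A₁ A₂ A₃ : Set} G r → Dec A₁ → Dec A₂ → Dec A₃ → Dec (LocalCond A₁ A₂ A₃ G r)
  localCond? G r d₁ d₂ d₃ =
          ((r ≟F 𝟙) →-dec (G ≟F 𝟙) →-dec (G ≟F 𝟙) →-dec (2 <? m) →-dec d₁)
    ×-dec ((r ≟F 𝟚) →-dec (G ≟F 𝟚) →-dec (G ≟F 𝟚) →-dec (2 <? l) →-dec d₂)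
    ×-dec ((r ≟F 𝟙) →-dec (G ≟F 𝟚) →-dec (G ≟F 𝟚) →-dec d₃)

  localCond≡allows : ∀ {A₁ A₂ A₃ : Set} G r (d₁ : Dec A₁) (d₂ : Dec A₂) (d₃ : Dec A₃) →
    LocallyValid A₁ A₂ A₃ G → Admissible G r →
    does (localCond? G r d₁ d₂ d₃) ≡ allows (shapeOf (does d₁) (does d₂) (does d₃)) r
  localCond≡allows G r d₁ d₂ d₃ valid adm with 2 <ᵇ m | <ᵇ-reflects-< 2 m | 2 <ᵇ l | <ᵇ-reflects-< 2 l
  localCond≡allows zero _ (yes a₁) _ _ (J₁⊆𝟙 , _) _ | _ | _ | _ | _ = contradiction (J₁⊆𝟙 a₁) λ ()
  localCond≡allows zero _ (no _) (yes a₂) _ (_ , J₂⊆𝟚 , _) _ | _ | _ | _ | _ = contradiction (J₂⊆𝟚 a₂) λ ()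
  localCond≡allows zero _ (no _) (no _) (yes a₃) (_ , _ , _ , J₃⊆𝟚) _ | _ | _ | _ | _ = contradiction (J₃⊆𝟚 a₃) λ ()
  localCond≡allows zero _ (no _) (no _) (no _) _ ≡.refl | _ | _ | _ | _ = ≡.refl
  localCond≡allows (suc zero) _ _ (yes a₂) _ (_ , J₂⊆𝟚 , _) _ | _ | _ | _ | _ = contradiction (J₂⊆𝟚 a₂) λ ()
  localCond≡allows (suc zero) _ _ (no _) (yes a₃) (_ , _ , _ , J₃⊆𝟚) _ | _ | _ | _ | _ = contradiction (J₃⊆𝟚 a₃) λ ()
  localCond≡allows (suc zero) zero d₁ (no _) (no _) _ _ | _ | _ | _ | _ = ≡.sym (allows-𝟘 (shapeOf (does d₁) false false))
  localCond≡allows (suc zero) (suc zero) (yes _) (no _) (no _) _ _ | _ | ofʸ _ | _ | _ = ≡.refl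
  localCond≡allows (suc zero) (suc zero) (yes _) (no _) (no _) _ _ | _ | ofⁿ _ | _ | _ = ≡.refl
  localCond≡allows (suc zero) (suc zero) (no _)  (no _) (no _) _ _ | _ | ofʸ _ | _ | _ = ≡.refl
  localCond≡allows (suc zero) (suc zero) (no _)  (no _) (no _) _ (_ , small) | _ | ofⁿ m≯2 | _ | _ =
    contradiction (small m≯2) λ ()
  localCond≡allows (suc zero) (suc (suc zero)) _ (no _) (no _) _ (r≢𝟚 , _) | _ | _ | _ | _ = contradiction ≡.refl r≢𝟚
  localCond≡allows (suc (suc zero)) _ (yes a₁) _ _ (J₁⊆𝟙 , _) _ | _ | _ | _ | _ = contradiction (J₁⊆𝟙 a₁) λ ()
  localCond≡allows (suc (suc zero)) _ (no _) (yes a₂) (no ¬a₃) (_ , _ , J₂⊆J₃ , _) _ | _ | _ | _ | _ =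
    contradiction (J₂⊆J₃ a₂) ¬a₃
  localCond≡allows (suc (suc zero)) zero (no _) d₂ d₃ _ _ | _ | _ | _ | _ = ≡.sym (allows-𝟘 (shapeOf false (does d₂) (does d₃)))
  localCond≡allows (suc (suc zero)) (suc zero) (no _) (yes _) (yes _) _ _ | _ | _ | _ | _ = ≡.refl
  localCond≡allows (suc (suc zero)) (suc zero) (no _) (no _)  (yes _) _ _ | _ | _ | _ | _ = ≡.refl
  localCond≡allows (suc (suc zero)) (suc zero) (no _) (no _)  (no _)  _ _ | _ | _ | _ | _ = ≡.refl
  localCond≡allows (suc (suc zero)) (suc (suc zero)) (no _) (yes _) (yes _) _ _ | _ | _ | _ | ofʸ _ = ≡.refl
  localCond≡allows (suc (suc zero)) (suc (suc zero)) (no _) (no _)  (yes _) _ _ | _ | _ | _ | ofʸ _ = ≡.refl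
  localCond≡allows (suc (suc zero)) (suc (suc zero)) (no _) (no _)  (no _)  _ _ | _ | _ | _ | ofʸ _ = ≡.refl
  localCond≡allows (suc (suc zero)) (suc (suc zero)) (no _) _ _ _ l≯2⇒r≢𝟚 | _ | _ | _ | ofⁿ l≯2 =
    contradiction ≡.refl (l≯2⇒r≢𝟚 l≯2)

  κ-shapeOf : ∀ {A₁ A₂ A₃ : Set} G (d₁ : Dec A₁) (d₂ : Dec A₂) (d₃ : Dec A₃) → LocallyValid A₁ A₂ A₃ G →
    (if does d₁ then m ∸ 1 else 1) *ℕ (if does d₂ then (l ∸ 1) *ℕ m else 1) *ℕ (if does d₃ ∧ not (does d₂) then m else 1)
      ≡ κ G (shapeOf (does d₁) (does d₂) (does d₃))
  κ-shapeOf G (yes a₁) (yes a₂) _ (J₁⊆𝟙 , J₂⊆𝟚 , _) = contradiction (≡.trans (≡.sym (J₁⊆𝟙 a₁)) (J₂⊆𝟚 a₂)) λ ()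
  κ-shapeOf G (yes a₁) (no _) (yes a₃) (J₁⊆𝟙 , _ , _ , J₃⊆𝟚) = contradiction (≡.trans (≡.sym (J₁⊆𝟙 a₁)) (J₃⊆𝟚 a₃)) λ ()
  κ-shapeOf G (no _) (yes a₂) (no ¬a₃) (_ , _ , J₂⊆J₃ , _) = contradiction (J₂⊆J₃ a₂) ¬a₃
  κ-shapeOf G (yes a₁) (no _) (no _) (J₁⊆𝟙 , _) rewrite J₁⊆𝟙 a₁ = ≡.trans (ℕₚ.*-identityʳ _) (ℕₚ.*-identityʳ _)
  κ-shapeOf G (no _) (yes a₂) (yes _) (_ , J₂⊆𝟚 , _) rewrite J₂⊆𝟚 a₂ = ≡.trans (ℕₚ.*-identityʳ _) (ℕₚ.*-identityˡ _)
  κ-shapeOf G (no _) (no _) (yes a₃) (_ , _ , _ , J₃⊆𝟚) rewrite J₃⊆𝟚 a₃ = ℕₚ.*-identityˡ _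
  κ-shapeOf G (no _) (no _) (no _) _ = ≡.refl

  inJ₁ inJ₂ inJ₃ : Fin 3 → Shape → Bool
  inJ₁ G s = does (G ≟F 𝟙) ∧ notDiag s ∧ does (2 <? m)
  inJ₂ G s = does (G ≟F 𝟚) ∧ isFull s ∧ does (2 <? l)
  inJ₃ G s = does (G ≟F 𝟚) ∧ notDiag s

  -- the shape that the triple built from s has at this coordinate; it can differ from s only where
  -- the two shapes agree on R_G(x₀) × R_G(x₀) (realize-allows)
  realize : Fin 3 → Shape → Shape
  realize G s = shapeOf (inJ₁ G s) (inJ₂ G s) (inJ₃ G s)

  inJ₁-sound : ∀ G s → inJ₁ G s ≡ true → G ≡ 𝟙 × 2 < m
  inJ₁-sound G s J₁∋ with G ≟F 𝟙 | 2 <ᵇ m | <ᵇ-reflects-< 2 m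
  inJ₁-sound G block _  | yes G≡𝟙 | _ | ofʸ 2<m = G≡𝟙 , 2<m
  inJ₁-sound G full  _  | yes G≡𝟙 | _ | ofʸ 2<m = G≡𝟙 , 2<m
  inJ₁-sound G diag  () | yes _   | _ | _
  inJ₁-sound G block () | yes _   | _ | ofⁿ _
  inJ₁-sound G full  () | yes _   | _ | ofⁿ _
  inJ₁-sound G s     () | no _    | _ | _

  inJ₂-sound : ∀ G s → inJ₂ G s ≡ true → G ≡ 𝟚 × 2 < l
  inJ₂-sound G s J₂∋ with G ≟F 𝟚 | 2 <ᵇ l | <ᵇ-reflects-< 2 l
  inJ₂-sound G full  _  | yes G≡𝟚 | _ | ofʸ 2<l = G≡𝟚 , 2<l
  inJ₂-sound G full  () | yes _   | _ | ofⁿ _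
  inJ₂-sound G diag  () | yes _   | _ | _
  inJ₂-sound G block () | yes _   | _ | _
  inJ₂-sound G s     () | no _    | _ | _

  inJ₂⇒inJ₃ : ∀ G s → inJ₂ G s ≡ true → inJ₃ G s ≡ true
  inJ₂⇒inJ₃ G s J₂∋ with G ≟F 𝟚
  inJ₂⇒inJ₃ G full  _  | yes _ = ≡.refl
  inJ₂⇒inJ₃ G diag  () | yes _
  inJ₂⇒inJ₃ G block () | yes _
  inJ₂⇒inJ₃ G s     () | no _

  inJ₃-sound : ∀ G s → inJ₃ G s ≡ true → G ≡ 𝟚
  inJ₃-sound G s J₃∋ with G ≟F 𝟚
  inJ₃-sound G s _  | yes G≡𝟚 = G≡𝟚
  inJ₃-sound G s () | no _

  realize-allows : ∀ G s r → Admissible G r → allows (realize G s) r ≡ allows s r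
  realize-allows G s r adm with 2 <ᵇ m | <ᵇ-reflects-< 2 m | 2 <ᵇ l | <ᵇ-reflects-< 2 l
  realize-allows zero s _ ≡.refl | _ | _ | _ | _ = ≡.sym (allows-𝟘 s)
  realize-allows (suc zero) diag r adm | _ | _ | _ | _ = ≡.refl
  realize-allows (suc zero) block zero adm | _ | ofʸ _ | _ | _ = ≡.refl
  realize-allows (suc zero) block (suc zero) adm | _ | ofʸ _ | _ | _ = ≡.refl
  realize-allows (suc zero) full r adm | _ | ofʸ _ | _ | _ = ≡.refl
  realize-allows (suc zero) block (suc (suc zero)) (r≢𝟚 , _) | _ | _ | _ | _ = contradiction ≡.refl r≢𝟚
  realize-allows (suc zero) block r (_ , small) | _ | ofⁿ m≯2 | _ | _ rewrite small m≯2 = ≡.refl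
  realize-allows (suc zero) full  r (_ , small) | _ | ofⁿ m≯2 | _ | _ rewrite small m≯2 = ≡.refl
  realize-allows (suc (suc zero)) diag r adm | _ | _ | _ | _ = ≡.refl
  realize-allows (suc (suc zero)) block r adm | _ | _ | _ | _ = ≡.refl
  realize-allows (suc (suc zero)) full r adm | _ | _ | _ | ofʸ _ = ≡.refl
  realize-allows (suc (suc zero)) full zero adm | _ | _ | _ | ofⁿ _ = ≡.refl
  realize-allows (suc (suc zero)) full (suc zero) adm | _ | _ | _ | ofⁿ _ = ≡.refl
  realize-allows (suc (suc zero)) full (suc (suc zero)) l≯2⇒r≢𝟚 | _ | _ | _ | ofⁿ l≯2 = contradiction ≡.refl (l≯2⇒r≢𝟚 l≯2)

  realize-κ : 2 ≤ l → 2 ≤ m → ∀ G s → κ G (realize G s) ≡ κ G s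
  realize-κ 2≤l 2≤m G s with 2 <ᵇ m | <ᵇ-reflects-< 2 m | 2 <ᵇ l | <ᵇ-reflects-< 2 l
  realize-κ 2≤l 2≤m zero diag  | _ | _ | _ | _ = ≡.refl
  realize-κ 2≤l 2≤m zero block | _ | _ | _ | _ = ≡.refl
  realize-κ 2≤l 2≤m zero full  | _ | _ | _ | _ = ≡.refl
  realize-κ 2≤l 2≤m (suc zero) diag  | _ | _ | _ | _ = ≡.refl
  realize-κ 2≤l 2≤m (suc zero) block | _ | ofʸ _ | _ | _ = ≡.refl
  realize-κ 2≤l 2≤m (suc zero) full  | _ | ofʸ _ | _ | _ = ≡.refl
  realize-κ 2≤l 2≤m (suc zero) block | _ | ofⁿ m≯2 | _ | _ = ≡.cong (_∸ 1) (≤∧≮⇒≡ 2≤m m≯2)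
  realize-κ 2≤l 2≤m (suc zero) full  | _ | ofⁿ m≯2 | _ | _ = ≡.cong (_∸ 1) (≤∧≮⇒≡ 2≤m m≯2)
  realize-κ 2≤l 2≤m (suc (suc zero)) diag  | _ | _ | _ | _ = ≡.refl
  realize-κ 2≤l 2≤m (suc (suc zero)) block | _ | _ | _ | _ = ≡.refl
  realize-κ 2≤l 2≤m (suc (suc zero)) full  | _ | _ | _ | ofʸ _ = ≡.refl
  realize-κ 2≤l 2≤m (suc (suc zero)) full  | _ | _ | _ | ofⁿ l≯2 =
    ≡.trans (≡.sym (ℕₚ.+-identityʳ m)) (≡.cong (λ k → (k ∸ 1) *ℕ m) (≤∧≮⇒≡ 2≤l l≯2))

  shapeMatrix-cong : ∀ G s s′ → (∀ r → Admissible G r → allows s r ≡ allows s′ r) →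
                     ∀ u v → shapeMatrix G s u v ≈ shapeMatrix G s′ u v
  shapeMatrix-cong G s s′ same u v with rel x₀ u ≟F G | rel x₀ v ≟F G
  ... | yes x₀Gu | yes x₀Gv = *-congˡ (reflexive (≡.cong ⟦_⟧ (same _ (admissible G u v x₀Gu x₀Gv))))
  ... | no _     | _        = trans (*-congʳ (zeroˡ _)) (trans (zeroˡ _) (sym (trans (*-congʳ (zeroˡ _)) (zeroˡ _))))
  ... | yes _    | no _     = trans (*-congʳ (zeroʳ _)) (trans (zeroˡ _) (sym (trans (*-congʳ (zeroʳ _)) (zeroˡ _))))

  R-nonempty : 2 ≤ l → 2 ≤ m → ∀ G → Σ Point (λ u → rel x₀ u ≡ G)
  R-nonempty 2≤l 2≤m zero             = x₀ , rel-refl x₀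
  R-nonempty 2≤l 2≤m (suc zero)       = let q , q₀≢q = another 2≤m q₀ in (b₀ , q) , rel-sameBlock b₀ q₀≢q
  R-nonempty 2≤l 2≤m (suc (suc zero)) = let b , b₀≢b = another 2≤l b₀ in (b , q₀) , rel-otherBlock q₀ q₀ b₀≢b

  shapeMatrix-diagonal : ∀ G s u → rel x₀ u ≡ G → shapeMatrix G s u u ≈ 1#
  shapeMatrix-diagonal G s u x₀Gu =
    trans (*-cong (trans (*-cong (χ-∈ x₀Gu) (χ-∈ x₀Gu)) (*-identityˡ 1#)) (allowed-refl s u)) (*-identityˡ 1#)

-- The product scheme

module ProductScheme {c ℓ} (F : Field c ℓ) (n : ℕ) (L M : Fin n → ℕ) (x : Pt n L M) where
  open Scheme F n L M x
  open Field F hiding (zero)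
  open FiniteSums commutativeRing
  open FieldFacts F
  module C (i : Fin n) = Coordinate F (x i)
  open ShapeExpansion commutativeRing using (γ; γ-expansion)

  Mat-setoid : Setoid c ℓ
  Mat-setoid = record
    { Carrier       = Mat
    ; _≈_           = _≈M_
    ; isEquivalence = record
      { refl  = λ _ _ → refl
      ; sym   = λ A≈B y z → sym (A≈B y z)
      ; trans = λ A≈B B≈C y z → trans (A≈B y z) (B≈C y z)
      }
    }

  module ≈M = Setoid Mat-setoid

  ⊙-cong : ∀ {A A′ B B′} → A ≈M A′ → B ≈M B′ → (A ⊙ B) ≈M (A′ ⊙ B′)
  ⊙-cong A≈A′ B≈B′ y z = sumL-cong allX (λ w → *-cong (A≈A′ y w) (B≈B′ w z))

  +M-cong : ∀ {A A′ B B′} → A ≈M A′ → B ≈M B′ → (A +M B) ≈M (A′ +M B′)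
  +M-cong A≈A′ B≈B′ y z = +-cong (A≈A′ y z) (B≈B′ y z)

  ·M-cong : ∀ t {A A′} → A ≈M A′ → (t ·M A) ≈M (t ·M A′)
  ·M-cong t A≈A′ y z = *-congˡ (A≈A′ y z)

  ⊙-distribʳ : ∀ A A′ B → ((A +M A′) ⊙ B) ≈M ((A ⊙ B) +M (A′ ⊙ B))
  ⊙-distribʳ A A′ B y z = trans (sumL-cong allX (λ w → distribʳ _ _ _)) (sumL-distrib-+ _ _ allX)

  ⊙-distribˡ : ∀ A B B′ → (A ⊙ (B +M B′)) ≈M ((A ⊙ B) +M (A ⊙ B′))
  ⊙-distribˡ A B B′ y z = trans (sumL-cong allX (λ w → distribˡ _ _ _)) (sumL-distrib-+ _ _ allX)

  ⊙-·ˡ : ∀ t A B → ((t ·M A) ⊙ B) ≈M (t ·M (A ⊙ B))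
  ⊙-·ˡ t A B y z = trans (sumL-cong allX (λ w → *-assoc _ _ _)) (sumL-*ˡ _ _ allX)

  ⊙-·ʳ : ∀ t A B → (A ⊙ (t ·M B)) ≈M (t ·M (A ⊙ B))
  ⊙-·ʳ t A B y z = trans (sumL-cong allX (λ w → x*yz≈y*xz (A y w) t (B w z))) (sumL-*ˡ _ _ allX)

  ⊙-zeroˡ : ∀ B → (O ⊙ B) ≈M O
  ⊙-zeroˡ B y z = sumL-zero _ allX (λ w → zeroˡ _)

  ⊙-zeroʳ : ∀ A → (A ⊙ O) ≈M O
  ⊙-zeroʳ A y z = sumL-zero _ allX (λ w → zeroʳ _)

  Local : Set c
  Local = (i : Fin n) → U n L M i → U n L M i → Carrier

  ⨂ : Local → Mat
  ⨂ t y z = ∏ (λ i → t i (y i) (z i))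

  ⨂-cong : ∀ {t t′ : Local} → (∀ i u v → t i u v ≈ t′ i u v) → ⨂ t ≈M ⨂ t′
  ⨂-cong t≈t′ y z = ∏-cong (λ i → t≈t′ i (y i) (z i))

  ⨂-⊙ : ∀ t t′ → (⨂ t ⊙ ⨂ t′) ≈M ⨂ (λ i u v → C.∑U i (λ w → t i u w * t′ i w v))
  ⨂-⊙ t t′ y z = trans (sumL-cong allX (λ w → sym (∏-distrib-* (λ i → t i (y i) (w i)) (λ i → t′ i (w i) (z i)))))
                       (sumL-allFun-∏ n (U n L M) C.points (λ i w → t i (y i) w * t′ i w (z i)))

  ⟦all?⟧ : ∀ {P : Fin n → Set} (P? : ∀ i → Dec (P i)) → ⟦ does (all? P?) ⟧ ≈ ∏ (λ i → ⟦ does (P? i) ⟧)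
  ⟦all?⟧ {P} P? = by-dec (all? P?)
    where
    by-dec : (d : Dec (∀ i → P i)) → ⟦ does d ⟧ ≈ ∏ (λ i → ⟦ does (P? i) ⟧)
    by-dec (yes ∀P) = sym (trans (∏-cong (λ i → reflexive (≡.cong ⟦_⟧ (dec-true (P? i) (∀P i))))) (∏-1 n))
    by-dec (no ¬∀P) with ¬∀⟶∃¬ n P P? ¬∀P
    ... | i , ¬Pi = sym (∏-zero _ i (reflexive (≡.cong ⟦_⟧ (dec-false (P? i) ¬Pi))))

  ⟦inR⟧ : ∀ a y z → ⟦ inR a y z ⟧ ≈ ∏ (λ i → ⟦ does (rel (y i) (z i) ≟F a i) ⟧)
  ⟦inR⟧ a y z = ⟦all?⟧ (λ i → rel (y i) (z i) ≟F a i)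

  Adj-⨂ : ∀ a → Adj a ≈M ⨂ (λ i u v → ⟦ does (rel u v ≟F a i) ⟧)
  Adj-⨂ a = ⟦inR⟧ a

  Id-⨂ : Id ≈M ⨂ C.idU
  Id-⨂ = ⟦inR⟧ (λ _ → 𝟘)

  Es-⨂ : ∀ h → Es h ≈M ⨂ (λ i u v → C.idU i u v * C.χ i (h i) u)
  Es-⨂ h y z = trans (⟦∧⟧ (inR (λ _ → 𝟘) y z) (inR h x y))
    (trans (*-cong (⟦inR⟧ (λ _ → 𝟘) y z) (⟦inR⟧ h x y))
           (sym (∏-distrib-* (λ i → C.idU i (y i) (z i)) (λ i → C.χ i (h i) (y i)))))

  Respects≡ : Mat → Set ℓ
  Respects≡ A = ∀ {y y′ z z′} → (∀ i → y i ≡ y′ i) → (∀ i → z i ≡ z′ i) → A y z ≈ A y′ z′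

  Symmetries : Set (c ⊔ ℓ)
  Symmetries = (i : Fin n) → C.Symmetry i

  act : Symmetries → X → X
  act σ y i = C.φ (σ i) (y i)

  Invariant : Mat → Set (c ⊔ ℓ)
  Invariant A = ∀ σ y z → A (act σ y) (act σ z) ≈ A y z

  inR-respects≡ : ∀ a y y′ z z′ → (∀ i → y i ≡ y′ i) → (∀ i → z i ≡ z′ i) → inR a y z ≡ inR a y′ z′
  inR-respects≡ a y y′ z z′ y≡y′ z≡z′ = does-⇔
    (mk⇔ (λ r≡a i → ≡.trans (≡.cong₂ rel (≡.sym (y≡y′ i)) (≡.sym (z≡z′ i))) (r≡a i))
         (λ r≡a i → ≡.trans (≡.cong₂ rel (y≡y′ i) (z≡z′ i)) (r≡a i)))
    (relE y z ≟E a) (relE y′ z′ ≟E a)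

  inR-invariant : ∀ σ a y z → inR a (act σ y) (act σ z) ≡ inR a y z
  inR-invariant σ a y z = does-⇔
    (mk⇔ (λ r≡a i → ≡.trans (≡.sym (C.φ-rel (σ i) (y i) (z i))) (r≡a i))
         (λ r≡a i → ≡.trans (C.φ-rel (σ i) (y i) (z i)) (r≡a i)))
    (relE (act σ y) (act σ z) ≟E a) (relE y z ≟E a)

  inR-x-invariant : ∀ σ a y → inR a x (act σ y) ≡ inR a x y
  inR-x-invariant σ a y = does-⇔
    (mk⇔ (λ r≡a i → ≡.trans (≡.sym (C.φ-relx₀ i (σ i) (y i))) (r≡a i))
         (λ r≡a i → ≡.trans (C.φ-relx₀ i (σ i) (y i)) (r≡a i)))
    (relE x (act σ y) ≟E a) (relE x y ≟E a)

  ⊙-invariant : ∀ {A B} → Respects≡ A → Invariant A → Respects≡ B → Invariant B → Invariant (A ⊙ B)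
  ⊙-invariant {A} {B} A-resp A-inv B-resp B-inv σ y z = begin
    sumL (λ w → A (act σ y) w * B w (act σ z)) allX
      ≈⟨ sumL-allFun-reindex n (U n L M) C.points (λ i → C.φ (σ i)) (λ i → C.∑U-φ (σ i))
           (λ w → A (act σ y) w * B w (act σ z))
           (λ w w′ w≡w′ → *-cong (A-resp (λ _ → ≡.refl) w≡w′) (B-resp w≡w′ (λ _ → ≡.refl))) ⟨
    sumL (λ w → A (act σ y) (act σ w) * B (act σ w) (act σ z)) allX
      ≈⟨ sumL-cong allX (λ w → *-cong (A-inv σ y w) (B-inv σ w z)) ⟩
    sumL (λ w → A y w * B w z) allX ∎
    where open import Relation.Binary.Reasoning.Setoid setoid

  InT-respects≡ : ∀ {A} → InT A → Respects≡ A
  InT-respects≡ (genA a)     y≡ z≡ = reflexive (≡.cong ⟦_⟧ (inR-respects≡ a _ _ _ _ y≡ z≡))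
  InT-respects≡ (genE a)     y≡ z≡ =
    reflexive (≡.cong ⟦_⟧ (≡.cong₂ _∧_ (inR-respects≡ _ _ _ _ _ y≡ z≡) (inR-respects≡ a x x _ _ (λ _ → ≡.refl) y≡)))
  InT-respects≡ one          y≡ z≡ = reflexive (≡.cong ⟦_⟧ (inR-respects≡ _ _ _ _ _ y≡ z≡))
  InT-respects≡ zer          y≡ z≡ = refl
  InT-respects≡ (add P Q)    y≡ z≡ = +-cong (InT-respects≡ P y≡ z≡) (InT-respects≡ Q y≡ z≡)
  InT-respects≡ (scl t P)    y≡ z≡ = *-congˡ (InT-respects≡ P y≡ z≡)
  InT-respects≡ (mul P Q)    y≡ z≡ =
    sumL-cong allX (λ w → *-cong (InT-respects≡ P y≡ (λ _ → ≡.refl)) (InT-respects≡ Q (λ _ → ≡.refl) z≡))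
  InT-respects≡ (resp A≈B P) y≡ z≡ = trans (sym (A≈B _ _)) (trans (InT-respects≡ P y≡ z≡) (A≈B _ _))

  InT-invariant : ∀ {A} → InT A → Invariant A
  InT-invariant (genA a)     σ y z = reflexive (≡.cong ⟦_⟧ (inR-invariant σ a y z))
  InT-invariant (genE a)     σ y z = reflexive (≡.cong ⟦_⟧ (≡.cong₂ _∧_ (inR-invariant σ _ y z) (inR-x-invariant σ a y)))
  InT-invariant one          σ y z = reflexive (≡.cong ⟦_⟧ (inR-invariant σ _ y z))
  InT-invariant zer          σ y z = refl
  InT-invariant (add P Q)    σ y z = +-cong (InT-invariant P σ y z) (InT-invariant Q σ y z)
  InT-invariant (scl t P)    σ y z = *-congˡ (InT-invariant P σ y z)
  InT-invariant (mul P Q)          = ⊙-invariant (InT-respects≡ P) (InT-invariant P) (InT-respects≡ Q) (InT-invariant Q)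
  InT-invariant (resp A≈B P) σ y z = trans (sym (A≈B _ _)) (trans (InT-invariant P σ y z) (A≈B y z))

  module Corner (g : E n) where

    χ² : ∀ i → U n L M i → U n L M i → Carrier
    χ² i u v = C.χ i (g i) u * C.χ i (g i) v

    EAE : E n → Mat
    EAE a = (Es g ⊙ Adj a) ⊙ Es g

    E*-local A-local : E n → Local
    E*-local h i u v = C.idU i u v * C.χ i (h i) u
    A-local  a i u v = ⟦ does (rel u v ≟F a i) ⟧

    EAE-local : ∀ a i u v →
      C.∑U i (λ w → C.∑U i (λ w′ → E*-local g i u w′ * A-local a i w′ w) * E*-local g i w v) ≈ χ² i u v * A-local a i u v
    EAE-local a i u v = begin
      C.∑U i (λ w → C.∑U i (λ w′ → (C.idU i u w′ * χ u) * A w′ w) * (C.idU i w v * χ w))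
        ≈⟨ C.∑U-cong i (λ w → *-congʳ (trans (C.∑U-cong i (λ w′ → trans (*-assoc _ _ _) (*-congˡ (*-comm _ _))))
                                              (C.∑U-idUˡ i u (λ w′ → A w′ w * χ u)))) ⟩
      C.∑U i (λ w → (A u w * χ u) * (C.idU i w v * χ w))
        ≈⟨ C.∑U-cong i (λ w → trans (*-congˡ (*-comm _ _)) (sym (*-assoc _ _ _))) ⟩
      C.∑U i (λ w → ((A u w * χ u) * χ w) * C.idU i w v)
        ≈⟨ C.∑U-idUʳ i v _ ⟩
      (A u v * χ u) * χ v
        ≈⟨ trans (*-assoc _ _ _) (*-comm _ _) ⟩
      χ² i u v * A u v ∎
      where
      open import Relation.Binary.Reasoning.Setoid setoid
      χ = C.χ i (g i)
      A = A-local a i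

    EAE-⨂ : ∀ a → EAE a ≈M ⨂ (λ i u v → χ² i u v * A-local a i u v)
    EAE-⨂ a = begin
      (Es g ⊙ Adj a) ⊙ Es g                                 ≈⟨ ⊙-cong (⊙-cong (Es-⨂ g) (Adj-⨂ a)) (Es-⨂ g) ⟩
      (⨂ (E*-local g) ⊙ ⨂ (A-local a)) ⊙ ⨂ (E*-local g)     ≈⟨ ⊙-cong (⨂-⊙ (E*-local g) (A-local a)) ≈M.refl ⟩
      ⨂ EA ⊙ ⨂ (E*-local g)                                 ≈⟨ ⨂-⊙ EA (E*-local g) ⟩
      ⨂ (λ i u v → C.∑U i (λ w → EA i u w * E*-local g i w v)) ≈⟨ ⨂-cong (EAE-local a) ⟩
      ⨂ (λ i u v → χ² i u v * A-local a i u v)              ∎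
      where
      open import Relation.Binary.Reasoning.Setoid Mat-setoid
      EA : Local
      EA i u v = C.∑U i (λ w → E*-local g i u w * A-local a i w v)

    T : (Fin n → Shape) → Mat
    T s = ⨂ (λ i → C.shapeMatrix i (g i) (s i))

    _⊔ᵛ_ _⊓ᵛ_ : (Fin n → Shape) → (Fin n → Shape) → Fin n → Shape
    (s ⊔ᵛ t) i = s i ⊔ˢ t i
    (s ⊓ᵛ t) i = s i ⊓ˢ t i

    scalar : (Fin n → Shape) → (Fin n → Shape) → Carrier
    scalar s t = ∏ (λ i → ι F (C.κ i (g i) ((s ⊓ᵛ t) i)))

    T-⊙ : ∀ s t → (T s ⊙ T t) ≈M (scalar s t ·M T (s ⊔ᵛ t))
    T-⊙ s t y z = trans (⨂-⊙ (λ i → C.shapeMatrix i (g i) (s i)) (λ i → C.shapeMatrix i (g i) (t i)) y z)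
      (trans (∏-cong (λ i → C.shapeMatrix-mul i (g i) (s i) (t i) (y i) (z i)))
             (∏-distrib-* (λ i → ι F (C.κ i (g i) ((s ⊓ᵛ t) i))) (λ i → C.shapeMatrix i (g i) ((s ⊔ᵛ t) i) (y i) (z i))))

    T-⊙-Id : ∀ s → (T s ⊙ Id) ≈M T s
    T-⊙-Id s y z = trans (⊙-cong {A = T s} ≈M.refl Id-⨂ y z)
      (trans (⨂-⊙ (λ i → C.shapeMatrix i (g i) (s i)) C.idU y z)
             (∏-cong (λ i → C.∑U-idUʳ i (z i) (λ w → C.shapeMatrix i (g i) (s i) (y i) w))))

    shapeVectors : List (Fin n → Shape)
    shapeVectors = allFun n (λ _ → Shape) (λ _ → allShapes)

    sumMats-apply : ∀ {A : Set} (f : A → Mat) xs y z → sumMats (map f xs) y z ≈ sumL (λ a → f a y z) xs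
    sumMats-apply f []       y z = refl
    sumMats-apply f (a ∷ xs) y z = +-congˡ (sumMats-apply f xs y z)

    EAE-expansion : ∀ a → EAE a ≈M sumMats (map (λ σ → ∏ (λ i → γ (a i) (σ i)) ·M T σ) shapeVectors)
    EAE-expansion a y z = begin
      EAE a y z
        ≈⟨ EAE-⨂ a y z ⟩
      ∏ (λ i → χ² i (y i) (z i) * ⟦ does (rel (y i) (z i) ≟F a i) ⟧)
        ≈⟨ ∏-cong (λ i → local i (y i) (z i)) ⟩
      ∏ (λ i → sumL (λ s → γ (a i) s * C.shapeMatrix i (g i) s (y i) (z i)) allShapes)
        ≈⟨ sumL-allFun-∏ n (λ _ → Shape) (λ _ → allShapes) (λ i s → γ (a i) s * C.shapeMatrix i (g i) s (y i) (z i)) ⟨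
      sumL (λ σ → ∏ (λ i → γ (a i) (σ i) * C.shapeMatrix i (g i) (σ i) (y i) (z i))) shapeVectors
        ≈⟨ sumL-cong shapeVectors (λ σ → ∏-distrib-* (λ i → γ (a i) (σ i)) (λ i → C.shapeMatrix i (g i) (σ i) (y i) (z i))) ⟩
      sumL (λ σ → ∏ (λ i → γ (a i) (σ i)) * T σ y z) shapeVectors
        ≈⟨ sumMats-apply (λ σ → ∏ (λ i → γ (a i) (σ i)) ·M T σ) shapeVectors y z ⟨
      sumMats (map (λ σ → ∏ (λ i → γ (a i) (σ i)) ·M T σ) shapeVectors) y z ∎
      where
      open import Relation.Binary.Reasoning.Setoid setoid
      local : ∀ i u v → χ² i u v * ⟦ does (rel u v ≟F a i) ⟧ ≈ sumL (λ s → γ (a i) s * C.shapeMatrix i (g i) s u v) allShapes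
      local i u v = trans (*-congˡ (γ-expansion (a i) (rel u v)))
        (trans (sym (sumL-*ˡ (χ² i u v) (λ s → γ (a i) s * C.allowed i s u v) allShapes))
               (sumL-cong allShapes (λ s → x*yz≈y*xz (χ² i u v) (γ (a i) s) (C.allowed i s u v))))

    InRg : X → Set
    InRg y = ∀ i → rel (x i) (y i) ≡ g i

    InRg? : ∀ y → Dec (InRg y)
    InRg? y = all? (λ i → rel (x i) (y i) ≟F g i)

    HasProfile : E n → X × X → Set
    HasProfile a (y , z) = (InRg y × InRg z) × (∀ i → rel (y i) (z i) ≡ a i)

    hasProfile? : ∀ a yz → Dec (HasProfile a yz)
    hasProfile? a (y , z) = (InRg? y ×-dec InRg? z) ×-dec all? (λ i → rel (y i) (z i) ≟F a i)

    allX-complete : ∀ y → Any (λ y′ → ∀ i → y′ i ≡ y i) allX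
    allX-complete = allFun-complete n (U n L M) C.points
                      (λ i u → ∈-cartesianProduct⁺ (∈-allFin (proj₁ u)) (∈-allFin (proj₂ u)))

    -- the value of N on some pair with profile a, and 0 if there is none
    coefficient : Mat → E n → Carrier
    coefficient N a = value (anyₗ? (hasProfile? a) (cartesianProduct allX allX))
      where
      value : Dec (Any (HasProfile a) (cartesianProduct allX allX)) → Carrier
      value (yes found) = let (y , z) , _ = satisfied found in N y z
      value (no _)      = 0#

    coefficient-spec : ∀ N → Respects≡ N → Invariant N → ∀ a y z → HasProfile a (y , z) → coefficient N a ≈ N y z
    coefficient-spec N N-resp N-inv a y z ((y∈ , z∈) , yz∈a) with anyₗ? (hasProfile? a) (cartesianProduct allX allX)
    ... | yes found with satisfied found
    ...   | (y′ , z′) , ((y′∈ , z′∈) , y′z′∈a) =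
      trans (sym (N-inv σ y′ z′)) (N-resp (λ i → proj₁ (proj₂ (moves i))) (λ i → proj₂ (proj₂ (moves i))))
      where
      moves : ∀ i → Σ (C.Symmetry i) λ α → C.φ α (y′ i) ≡ y i × C.φ α (z′ i) ≡ z i
      moves i = C.transitive i (y i) (z i) (y′ i) (z′ i) (≡.trans (y′∈ i) (≡.sym (y∈ i))) (≡.trans (z′∈ i) (≡.sym (z∈ i)))
                  (≡.trans (y′z′∈a i) (≡.sym (yz∈a i)))
      σ : Symmetries
      σ i = proj₁ (moves i)
    coefficient-spec N N-resp N-inv a y z ((y∈ , z∈) , yz∈a) | no none
      with find (allX-complete y) | find (allX-complete z)
    ... | y′ , y′∈allX , y′≡y | z′ , z′∈allX , z′≡z = contradiction
      (lose (∈-cartesianProduct⁺ y′∈allX z′∈allX)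
            ((  (λ i → ≡.trans (≡.cong (rel (x i)) (y′≡y i)) (y∈ i))
              , (λ i → ≡.trans (≡.cong (rel (x i)) (z′≡z i)) (z∈ i)))
              , (λ i → ≡.trans (≡.cong₂ rel (y′≡y i) (z′≡z i)) (yz∈a i))))
      none

    ⟦inRg⟧-∈ : ∀ {y} → InRg y → ⟦ inR g x y ⟧ ≈ 1#
    ⟦inRg⟧-∈ {y} y∈ = reflexive (≡.cong ⟦_⟧ (dec-true (InRg? y) y∈))

    ⟦inRg⟧-∉ : ∀ {y} → ¬ InRg y → ⟦ inR g x y ⟧ ≈ 0#
    ⟦inRg⟧-∉ {y} y∉ = reflexive (≡.cong ⟦_⟧ (dec-false (InRg? y) y∉))

    δE : X → X → E n → Carrier
    δE y z a = ∏ (λ i → ⟦ does (rel (y i) (z i) ≟F a i) ⟧)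

    EAE-entry : ∀ a y z → EAE a y z ≈ (⟦ inR g x y ⟧ * ⟦ inR g x z ⟧) * δE y z a
    EAE-entry a y z = begin
      EAE a y z
        ≈⟨ EAE-⨂ a y z ⟩
      ∏ (λ i → χ² i (y i) (z i) * ⟦ does (rel (y i) (z i) ≟F a i) ⟧)
        ≈⟨ ∏-distrib-* (λ i → χ² i (y i) (z i)) (λ i → ⟦ does (rel (y i) (z i) ≟F a i) ⟧) ⟩
      ∏ (λ i → χ² i (y i) (z i)) * δE y z a
        ≈⟨ *-congʳ (∏-distrib-* (λ i → C.χ i (g i) (y i)) (λ i → C.χ i (g i) (z i))) ⟩
      (∏ (λ i → C.χ i (g i) (y i)) * ∏ (λ i → C.χ i (g i) (z i))) * δE y z a
        ≈⟨ *-congʳ (*-cong (⟦inR⟧ g x y) (⟦inR⟧ g x z)) ⟨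
      (⟦ inR g x y ⟧ * ⟦ inR g x z ⟧) * δE y z a ∎
      where open import Relation.Binary.Reasoning.Setoid setoid

    sumL-δE : ∀ y z → sumL (δE y z) allE ≈ 1#
    sumL-δE y z = trans (sumL-allFun-∏ n (λ _ → Fin 3) (λ _ → allFinL 3) (λ i → δ (rel (y i) (z i))))
                        (trans (∏-cong (λ i → sum-δ≈1 (rel (y i) (z i)))) (∏-1 n))
      where
      sum-δ≈1 : ∀ r → sumL (δ r) (allFinL 3) ≈ 1#
      sum-δ≈1 r = trans (sumL-allFin 3 (δ r)) (trans (sum-cong-≋ {3} (λ b → sym (*-identityʳ (δ r b)))) (∑-δ r (λ _ → 1#)))

    sift : ∀ y z (c : E n → Carrier) v → (∀ a → (∀ i → rel (y i) (z i) ≡ a i) → c a ≈ v) →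
           sumL (λ a → c a * δE y z a) allE ≈ v
    sift y z c v c≈v = begin
      sumL (λ a → c a * δE y z a) allE  ≈⟨ sumL-cong allE pointwise ⟩
      sumL (λ a → v * δE y z a) allE    ≈⟨ sumL-*ˡ v (δE y z) allE ⟩
      v * sumL (δE y z) allE            ≈⟨ trans (*-congˡ (sumL-δE y z)) (*-identityʳ v) ⟩
      v                                 ∎
      where
      open import Relation.Binary.Reasoning.Setoid setoid
      pointwise : ∀ a → c a * δE y z a ≈ v * δE y z a
      pointwise a with all? (λ i → rel (y i) (z i) ≟F a i)
      ... | yes profile = *-congʳ (c≈v a profile)
      ... | no ¬profile with ¬∀⟶∃¬ n _ (λ i → rel (y i) (z i) ≟F a i) ¬profile
      ...   | i , rᵢ≢aᵢ = trans (*-congˡ δE≈0) (trans (zeroʳ _) (sym (trans (*-congˡ δE≈0) (zeroʳ _))))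
        where δE≈0 = ∏-zero _ i (reflexive (≡.cong ⟦_⟧ (dec-false (rel (y i) (z i) ≟F a i) rᵢ≢aᵢ)))

    Supported : Mat → Set ℓ
    Supported N = ∀ y z → ¬ InRg y ⊎ ¬ InRg z → N y z ≈ 0#

    sumL-EAE : ∀ (f : E n → Carrier) y z v →
      (InRg y → InRg z → ∀ a → (∀ i → rel (y i) (z i) ≡ a i) → f a ≈ v) → (¬ InRg y ⊎ ¬ InRg z → v ≈ 0#) →
      sumL (λ a → f a * EAE a y z) allE ≈ v
    sumL-EAE f y z v f≈v v≈0 =
      trans (sumL-cong allE (λ a → *-congˡ (EAE-entry a y z))) (by-support (InRg? y) (InRg? z))
      where
      vanishing : ¬ InRg y ⊎ ¬ InRg z → ⟦ inR g x y ⟧ * ⟦ inR g x z ⟧ ≈ 0# →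
                  sumL (λ a → f a * ((⟦ inR g x y ⟧ * ⟦ inR g x z ⟧) * δE y z a)) allE ≈ v
      vanishing outside χχ≈0 =
        trans (sumL-zero _ allE (λ a → trans (*-congˡ (trans (*-congʳ χχ≈0) (zeroˡ _))) (zeroʳ _))) (sym (v≈0 outside))
      by-support : Dec (InRg y) → Dec (InRg z) → sumL (λ a → f a * ((⟦ inR g x y ⟧ * ⟦ inR g x z ⟧) * δE y z a)) allE ≈ v
      by-support (yes y∈) (yes z∈) =
        trans (sumL-cong allE (λ a → *-congˡ (trans (*-congʳ (trans (*-cong (⟦inRg⟧-∈ y∈) (⟦inRg⟧-∈ z∈)) (*-identityˡ 1#)))
                                                    (*-identityˡ _))))
              (sift y z f v (f≈v y∈ z∈))
      by-support (no y∉) _ = vanishing (inj₁ y∉) (trans (*-congʳ (⟦inRg⟧-∉ y∉)) (zeroˡ _))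
      by-support (yes _) (no z∉) = vanishing (inj₂ z∉) (trans (*-congˡ (⟦inRg⟧-∉ z∉)) (zeroʳ _))

    representation : ∀ N → Respects≡ N → Invariant N → Supported N →
                     N ≈M sumMats (map (λ a → coefficient N a ·M EAE a) allE)
    representation N N-resp N-inv N-supp y z = sym (trans
      (sumMats-apply (λ a → coefficient N a ·M EAE a) allE y z)
      (sumL-EAE (coefficient N) y z (N y z)
        (λ y∈ z∈ a profile → coefficient-spec N N-resp N-inv a y z ((y∈ , z∈) , profile)) (N-supp y z)))

    corner-supported : ∀ B → Supported ((Es g ⊙ B) ⊙ Es g)
    corner-supported B y z (inj₁ y∉) =
      sumL-zero _ allX (λ w → trans (*-congʳ (sumL-zero _ allX (λ v → trans (*-congʳ (row v)) (zeroˡ _)))) (zeroˡ _))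
      where
      row : ∀ v → Es g y v ≈ 0#
      row v = reflexive (≡.cong ⟦_⟧ (≡.trans (≡.cong (inR (λ _ → 𝟘) y v ∧_) (dec-false (InRg? y) y∉)) (∧-zeroʳ _)))
    corner-supported B y z (inj₂ z∉) = sumL-zero _ allX (λ w → trans (*-congˡ (column w (relE w z ≟E (λ _ → 𝟘)))) (zeroʳ _))
      where
      column : ∀ w → Dec (∀ i → relE w z i ≡ 𝟘) → Es g w z ≈ 0#
      column w (no w≁z)  = reflexive (≡.cong (λ b → ⟦ b ∧ inR g x w ⟧) (dec-false (relE w z ≟E (λ _ → 𝟘)) w≁z))
      column w (yes w~z) = reflexive (≡.cong ⟦_⟧ (≡.cong₂ _∧_ (dec-true (relE w z ≟E (λ _ → 𝟘)) w~z) w∉))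
        where
        w∉ : inR g x w ≡ false
        w∉ = ≡.trans (inR-respects≡ g x x w z (λ _ → ≡.refl) (λ i → Relations.rel≡𝟘⇒≡ (w i) (z i) (w~z i)))
                     (dec-false (InRg? z) z∉)

    locallyValid : ∀ {J₁ J₂ J₃} → ValidTau g g (J₁ , J₂ , J₃) → ∀ i → LocallyValid (i ∈ J₁) (i ∈ J₂) (i ∈ J₃) (g i)
    locallyValid (J₁-ok , J₂-ok , J₂⊆J₃ , J₃-ok) i = proj₁ ∘ J₁-ok i , proj₁ ∘ J₂-ok i , J₂⊆J₃ , proj₁ ∘ J₃-ok i

    chosen : Tau → E n → Bool
    chosen τ a = nonzeroB g a g ∧ does (condB? g g τ a)

    shapeOfτ : Tau → Fin n → Shape
    shapeOfτ (J₁ , J₂ , J₃) i = shapeOf (does (i ∈? J₁)) (does (i ∈? J₂)) (does (i ∈? J₃))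

    T-entry : ∀ s y z → T s y z ≈ (⟦ inR g x y ⟧ * ⟦ inR g x z ⟧) * ∏ (λ i → C.allowed i (s i) (y i) (z i))
    T-entry s y z = trans (∏-distrib-* (λ i → χ² i (y i) (z i)) (λ i → C.allowed i (s i) (y i) (z i)))
      (*-congʳ (trans (∏-distrib-* (λ i → C.χ i (g i) (y i)) (λ i → C.χ i (g i) (z i)))
                      (sym (*-cong (⟦inR⟧ g x y) (⟦inR⟧ g x z)))))

    nonzero-witness : ∀ a y z → HasProfile a (y , z) → nonzeroB g a g ≡ true
    nonzero-witness a y z ((y∈ , z∈) , yz∈a) with find (allX-complete y) | find (allX-complete z)
    ... | y′ , y′∈allX , y′≡y | z′ , z′∈allX , z′≡z =
      Equivalence.to T-≡ (Anyₚ.any⁺ _ (lose y′∈allX (Anyₚ.any⁺ _ (lose z′∈allX (Equivalence.from T-≡ all-true)))))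
      where
      all-true : (inR g x y′ ∧ inR a y′ z′ ∧ inR g x z′) ≡ true
      all-true = ≡.cong₂ _∧_ (dec-true (InRg? y′) (λ i → ≡.trans (≡.cong (rel (x i)) (y′≡y i)) (y∈ i)))
                   (≡.cong₂ _∧_ (dec-true (relE y′ z′ ≟E a) (λ i → ≡.trans (≡.cong₂ rel (y′≡y i) (z′≡z i)) (yz∈a i)))
                                (dec-true (InRg? z′) (λ i → ≡.trans (≡.cong (rel (x i)) (z′≡z i)) (z∈ i))))

    condB-allows : ∀ τ → ValidTau g g τ → ∀ a y z → HasProfile a (y , z) →
      ⟦ chosen τ a ⟧ ≈ ∏ (λ i → C.allowed i (shapeOfτ τ i) (y i) (z i))
    condB-allows τ@(J₁ , J₂ , J₃) valid a y z profile@((y∈ , z∈) , yz∈a) = begin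
      ⟦ chosen τ a ⟧
        ≡⟨ ≡.cong (λ b → ⟦ b ∧ does (condB? g g τ a) ⟧) (nonzero-witness a y z profile) ⟩
      ⟦ does (condB? g g τ a) ⟧
        ≈⟨ ⟦all?⟧ (λ i → C.localCond? i (g i) (a i) (i ∈? J₁) (i ∈? J₂) (i ∈? J₃)) ⟩
      ∏ (λ i → ⟦ does (C.localCond? i (g i) (a i) (i ∈? J₁) (i ∈? J₂) (i ∈? J₃)) ⟧)
        ≈⟨ ∏-cong (λ i → reflexive (≡.cong ⟦_⟧ (local i))) ⟩
      ∏ (λ i → C.allowed i (shapeOfτ τ i) (y i) (z i)) ∎
      where
      open import Relation.Binary.Reasoning.Setoid setoid
      local : ∀ i → does (C.localCond? i (g i) (a i) (i ∈? J₁) (i ∈? J₂) (i ∈? J₃)) ≡ allows (shapeOfτ τ i) (rel (y i) (z i))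
      local i = ≡.trans
        (C.localCond≡allows i (g i) (a i) (i ∈? J₁) (i ∈? J₂) (i ∈? J₃) (locallyValid valid i)
           (≡.subst (C.Admissible i (g i)) (yz∈a i) (C.admissible i (g i) (y i) (z i) (y∈ i) (z∈ i))))
        (≡.cong (allows (shapeOfτ τ i)) (≡.sym (yz∈a i)))

    if-apply : ∀ b (A : Mat) y z → (if b then A else O) y z ≈ ⟦ b ⟧ * A y z
    if-apply true  A y z = sym (*-identityˡ _)
    if-apply false A y z = sym (zeroˡ _)

    B-shape : ∀ τ → ValidTau g g τ → B g g τ ≈M T (shapeOfτ τ)
    B-shape τ valid y z = trans
      (sumMats-apply (λ a → if chosen τ a then EAE a else O) allE y z)
      (trans (sumL-cong allE (λ a → if-apply (chosen τ a) (EAE a) y z))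
             (sumL-EAE (λ a → ⟦ chosen τ a ⟧) y z (T (shapeOfτ τ) y z) on-corner off-corner))
      where
      on-corner : InRg y → InRg z → ∀ a → (∀ i → rel (y i) (z i) ≡ a i) → ⟦ chosen τ a ⟧ ≈ T (shapeOfτ τ) y z
      on-corner y∈ z∈ a profile = trans (condB-allows τ valid a y z ((y∈ , z∈) , profile)) (sym
        (trans (T-entry (shapeOfτ τ) y z) (trans (*-congʳ (trans (*-cong (⟦inRg⟧-∈ y∈) (⟦inRg⟧-∈ z∈)) (*-identityˡ 1#)))
                                                 (*-identityˡ _))))
      off-corner : ¬ InRg y ⊎ ¬ InRg z → T (shapeOfτ τ) y z ≈ 0#
      off-corner (inj₁ y∉) =
        trans (T-entry (shapeOfτ τ) y z) (trans (*-congʳ (trans (*-congʳ (⟦inRg⟧-∉ y∉)) (zeroˡ _))) (zeroˡ _))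
      off-corner (inj₂ z∉) =
        trans (T-entry (shapeOfτ τ) y z) (trans (*-congʳ (trans (*-congˡ (⟦inRg⟧-∉ z∉)) (zeroʳ _))) (zeroˡ _))

    k≡∏κ : ∀ τ → ValidTau g g τ → k τ ≡ ∏ℕ (λ i → C.κ i (g i) (shapeOfτ τ i))
    k≡∏κ (J₁ , J₂ , J₃) valid = begin
      prodSub J₁ (λ j → M j ∸ 1) *ℕ prodSub J₂ (λ j → (L j ∸ 1) *ℕ M j) *ℕ prodSub (J₃ ─ J₂) M
        ≡⟨ ≡.cong₂ _*ℕ_ (≡.cong₂ _*ℕ_ (prodSub≡∏ℕ J₁ _) (prodSub≡∏ℕ J₂ _)) (prodSub≡∏ℕ (J₃ ─ J₂) M) ⟩
      ∏ℕ f₁ *ℕ ∏ℕ f₂ *ℕ ∏ℕ f₃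
        ≡⟨ ≡.cong (_*ℕ ∏ℕ f₃) (∏ℕ-distrib-* f₁ f₂) ⟨
      ∏ℕ (λ i → f₁ i *ℕ f₂ i) *ℕ ∏ℕ f₃
        ≡⟨ ∏ℕ-distrib-* (λ i → f₁ i *ℕ f₂ i) f₃ ⟨
      ∏ℕ (λ i → f₁ i *ℕ f₂ i *ℕ f₃ i)
        ≡⟨ ∏ℕ-cong local ⟩
      ∏ℕ (λ i → C.κ i (g i) (shapeOfτ (J₁ , J₂ , J₃) i)) ∎
      where
      open ≡.≡-Reasoning
      f₁ f₂ f₃ : Fin n → ℕ
      f₁ i = if does (i ∈? J₁) then M i ∸ 1 else 1
      f₂ i = if does (i ∈? J₂) then (L i ∸ 1) *ℕ M i else 1
      f₃ i = if does (i ∈? (J₃ ─ J₂)) then M i else 1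
      local : ∀ i → f₁ i *ℕ f₂ i *ℕ f₃ i ≡ C.κ i (g i) (shapeOfτ (J₁ , J₂ , J₃) i)
      local i rewrite ∈?-─ J₃ J₂ i =
        C.κ-shapeOf i (g i) (i ∈? J₁) (i ∈? J₂) (i ∈? J₃) (locallyValid valid i)

    τOf : (Fin n → Shape) → Tau
    τOf s = Vec.tabulate (λ i → C.inJ₁ i (g i) (s i))
          , Vec.tabulate (λ i → C.inJ₂ i (g i) (s i))
          , Vec.tabulate (λ i → C.inJ₃ i (g i) (s i))

    τOf-valid : ∀ s → ValidTau g g (τOf s)
    τOf-valid s = (λ i i∈ → let G≡𝟙 , 2<M = C.inJ₁-sound i (g i) (s i) (∈-tabulate⁻ _ i∈) in G≡𝟙 , G≡𝟙 , 2<M)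
                , (λ i i∈ → let G≡𝟚 , 2<L = C.inJ₂-sound i (g i) (s i) (∈-tabulate⁻ _ i∈) in G≡𝟚 , G≡𝟚 , 2<L)
                , (λ {i} i∈ → ∈-tabulate⁺ _ (C.inJ₂⇒inJ₃ i (g i) (s i) (∈-tabulate⁻ _ i∈)))
                , (λ i i∈ → let G≡𝟚 = C.inJ₃-sound i (g i) (s i) (∈-tabulate⁻ _ i∈) in G≡𝟚 , G≡𝟚)

    shapeOfτ-τOf : ∀ s i → shapeOfτ (τOf s) i ≡ C.realize i (g i) (s i)
    shapeOfτ-τOf s i rewrite ∈?-tabulate (λ i → C.inJ₁ i (g i) (s i)) i
                          | ∈?-tabulate (λ i → C.inJ₂ i (g i) (s i)) i
                          | ∈?-tabulate (λ i → C.inJ₃ i (g i) (s i)) i = ≡.refl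

    T-τOf : ∀ s → T (shapeOfτ (τOf s)) ≈M T s
    T-τOf s = ⨂-cong (λ i u v → trans (reflexive (≡.cong (λ t → C.shapeMatrix i (g i) t u v) (shapeOfτ-τOf s i)))
      (C.shapeMatrix-cong i (g i) (C.realize i (g i) (s i)) (s i) (C.realize-allows i (g i) (s i)) u v))

    κ-τOf : (∀ i → 2 ≤ L i) → (∀ i → 2 ≤ M i) → ∀ s i → C.κ i (g i) (shapeOfτ (τOf s) i) ≡ C.κ i (g i) (s i)
    κ-τOf 2≤L 2≤M s i = ≡.trans (≡.cong (C.κ i (g i)) (shapeOfτ-τOf s i)) (C.realize-κ i (2≤L i) (2≤M i) (g i) (s i))

    ι-k : ∀ τ → ValidTau g g τ → ι F (k τ) ≈ ∏ (λ i → ι F (C.κ i (g i) (shapeOfτ τ i)))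
    ι-k τ valid = trans (reflexive (≡.cong (ι F) (k≡∏κ τ valid))) (ι-∏ℕ (λ i → C.κ i (g i) (shapeOfτ τ i)))

    sandwich : Mat → Mat
    sandwich B = (Es g ⊙ B) ⊙ Es g

    sandwich-O : sandwich O ≈M O
    sandwich-O = ≈M.trans (⊙-cong (⊙-zeroʳ _) ≈M.refl) (⊙-zeroˡ _)

    sandwich-+ : ∀ B B′ → sandwich (B +M B′) ≈M (sandwich B +M sandwich B′)
    sandwich-+ B B′ = ≈M.trans (⊙-cong (⊙-distribˡ _ _ _) ≈M.refl) (⊙-distribʳ _ _ _)

    sandwich-· : ∀ t B → sandwich (t ·M B) ≈M (t ·M sandwich B)
    sandwich-· t B = ≈M.trans (⊙-cong (⊙-·ʳ _ _ _) ≈M.refl) (⊙-·ˡ _ _ _)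

    B∈corner : ∀ τ → InETE g (B g g τ)
    B∈corner τ = _ , middle∈T allE , sandwich-sum allE
      where
      middle : List (E n) → Mat
      middle as = sumMats (map (λ a → if chosen τ a then Adj a else O) as)
      middle∈T : ∀ as → InT (middle as)
      middle∈T []       = zer
      middle∈T (a ∷ as) with chosen τ a
      ... | true  = add (genA a) (middle∈T as)
      ... | false = add zer (middle∈T as)
      sandwich-sum : ∀ as → sumMats (map (λ a → if chosen τ a then EAE a else O) as) ≈M sandwich (middle as)
      sandwich-sum []       = ≈M.sym sandwich-O
      sandwich-sum (a ∷ as) with chosen τ a
      ... | true  = ≈M.trans (+M-cong ≈M.refl (sandwich-sum as)) (≈M.sym (sandwich-+ _ _))
      ... | false = ≈M.trans (+M-cong (≈M.sym sandwich-O) (sandwich-sum as)) (≈M.sym (sandwich-+ _ _))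

    ℐ⊆corner : ∀ {A} → InI g A → InETE g A
    ℐ⊆corner (gen τ _ _) = B∈corner τ
    ℐ⊆corner zer = O , zer , ≈M.sym sandwich-O
    ℐ⊆corner (add P Q) with ℐ⊆corner P | ℐ⊆corner Q
    ... | B₁ , B₁∈T , A₁≈ | B₂ , B₂∈T , A₂≈ =
      B₁ +M B₂ , add B₁∈T B₂∈T , ≈M.trans (+M-cong A₁≈ A₂≈) (≈M.sym (sandwich-+ B₁ B₂))
    ℐ⊆corner (scl t P) with ℐ⊆corner P
    ... | B₁ , B₁∈T , A₁≈ = t ·M B₁ , scl t B₁∈T , ≈M.trans (·M-cong t A₁≈) (≈M.sym (sandwich-· t B₁))
    ℐ⊆corner (resp A≈C P) with ℐ⊆corner P
    ... | B₁ , B₁∈T , A₁≈ = B₁ , B₁∈T , ≈M.trans (≈M.sym A≈C) A₁≈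

    single : Fin n → Fin n → Shape
    single d j = if does (d ≟F j) then full else diag

    single-≢ : ∀ {d j} → d ≢ j → single d j ≡ diag
    single-≢ {d} {j} d≢j = ≡.cong (if_then full else diag) (dec-false (d ≟F j) d≢j)

    generators : ∀ r (ds : List (Fin n)) → r ≤ length ds → Vec Mat r
    generators zero    _        _        = []
    generators (suc r) (d ∷ ds) (s≤s le) = T (single d) ∷ generators r ds le

    generators-product : ∀ r ds (le : suc r ≤ length ds) → Unique ds →
      Σ (Fin n → Shape) λ s → prodV (generators (suc r) ds le) ≈M T s × (∀ j → ¬ j ∈ₗ ds → s j ≡ diag)
    generators-product zero (d ∷ ds) (s≤s z≤n) _ =
      single d , T-⊙-Id (single d) , λ j j∉ → single-≢ (λ d≡j → j∉ (here (≡.sym d≡j)))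
    generators-product (suc r) (d ∷ ds) (s≤s le) (d∉ds ∷ unique) with generators-product r ds le unique
    ... | s , prod≈T , s-support = single d ⊔ᵛ s , prod≈ , support
      where
      disjoint : ∀ j → (single d ⊓ᵛ s) j ≡ diag
      disjoint j with d ≟F j
      ... | yes ≡.refl = ≡.cong (full ⊓ˢ_) (s-support d (λ d∈ds → All.lookup d∉ds d∈ds ≡.refl))
      ... | no _       = ≡.refl
      scalar≈1 : scalar (single d) s ≈ 1#
      scalar≈1 = trans (∏-cong (λ j → trans (reflexive (≡.cong (λ t → ι F (C.κ j (g j) t)) (disjoint j))) ι-1)) (∏-1 n)
      prod≈ : (T (single d) ⊙ prodV (generators (suc r) ds le)) ≈M T (single d ⊔ᵛ s)
      prod≈ = ≈M.trans (⊙-cong ≈M.refl prod≈T)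
               (≈M.trans (T-⊙ (single d) s) (λ y z → trans (*-congʳ scalar≈1) (*-identityˡ _)))
      support : ∀ j → ¬ j ∈ₗ d ∷ ds → (single d ⊔ᵛ s) j ≡ diag
      support j j∉ = ≡.cong₂ _⊔ˢ_ (single-≢ (λ d≡j → j∉ (here (≡.sym d≡j)))) (s-support j (j∉ ∘ there))

    T-diagonal : ∀ s {y} → InRg y → T s y y ≈ 1#
    T-diagonal s {y} y∈ = trans (∏-cong (λ i → C.shapeMatrix-diagonal i (g i) (s i) (y i) (y∈ i))) (∏-1 n)

    InRg-nonempty : (∀ i → 2 ≤ L i) → (∀ i → 2 ≤ M i) → Σ X InRg
    InRg-nonempty 2≤L 2≤M = (λ i → proj₁ (point i)) , (λ i → proj₂ (point i))
      where point = λ i → C.R-nonempty i (2≤L i) (2≤M i) (g i)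

    module Weights (p : ℕ) (char : IsCharacteristic F p) where

      ι≈0⇒∣ : ∀ a → ι F a ≈ 0# → p ∣ a
      ι≈0⇒∣ a = Equivalence.to (proj₂ char a)

      ∣⇒ι≈0 : ∀ a → p ∣ a → ι F a ≈ 0#
      ∣⇒ι≈0 a = Equivalence.from (proj₂ char a)

      Bad : (Fin n → Shape) → Fin n → Set
      Bad s i = p ∣ C.κ i (g i) (s i)

      bad? : ∀ s → Decidable (Bad s)
      bad? s i = p ∣? C.κ i (g i) (s i)

      weight : (Fin n → Shape) → ℕ
      weight s = count (bad? s) (allFinL n)

      Bad-⊔ˡ : ∀ s t i → Bad s i → Bad (s ⊔ᵛ t) i
      Bad-⊔ˡ s t i bad = ∣-trans bad (C.κ-∣-⊔ˡ i (g i) (s i) (t i))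

      Bad-⊔ʳ : ∀ s t i → Bad t i → Bad (s ⊔ᵛ t) i
      Bad-⊔ʳ s t i bad = ∣-trans bad (C.κ-∣-⊔ʳ i (g i) (s i) (t i))

      Bad-⊓ : ∀ s t i → Bad s i → Bad t i → Bad (s ⊓ᵛ t) i
      Bad-⊓ s t i bad-s bad-t with ⊓ˢ-sel (s i) (t i)
      ... | inj₁ s⊓t≡s = ≡.subst (λ u → p ∣ C.κ i (g i) u) (≡.sym s⊓t≡s) bad-s
      ... | inj₂ s⊓t≡t = ≡.subst (λ u → p ∣ C.κ i (g i) u) (≡.sym s⊓t≡t) bad-t

      weight-⊔ : ∀ s t → (∀ i → Bad s i → ¬ Bad t i) → weight s +ℕ weight t ≤ weight (s ⊔ᵛ t)
      weight-⊔ s t disjoint = count-+-disjoint (bad? s) (bad? t) (bad? (s ⊔ᵛ t))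
                                (Bad-⊔ˡ s t) (Bad-⊔ʳ s t) disjoint (allFinL n)

      scalar-≈0 : ∀ s t i → Bad s i → Bad t i → scalar s t ≈ 0#
      scalar-≈0 s t i bad-s bad-t = ∏-zero _ i (∣⇒ι≈0 _ (Bad-⊓ s t i bad-s bad-t))

      data Span≥ (w : ℕ) : Mat → Set (c ⊔ ℓ) where
        gen  : ∀ s → w ≤ weight s → Span≥ w (T s)
        zer  : Span≥ w O
        add  : ∀ {A C} → Span≥ w A → Span≥ w C → Span≥ w (A +M C)
        scl  : ∀ t {A} → Span≥ w A → Span≥ w (t ·M A)
        resp : ∀ {A C} → A ≈M C → Span≥ w A → Span≥ w C

      T-⊙-Span≥ : ∀ {a b} s t → a ≤ weight s → b ≤ weight t → Span≥ (a +ℕ b) (T s ⊙ T t)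
      T-⊙-Span≥ s t a≤ b≤ with any? (λ i → bad? s i ×-dec bad? t i)
      ... | yes (i , bad-s , bad-t) =
        resp (≈M.sym (≈M.trans (T-⊙ s t) (λ y z → trans (*-congʳ (scalar-≈0 s t i bad-s bad-t)) (zeroˡ _)))) zer
      ... | no ¬shared = resp (≈M.sym (T-⊙ s t)) (scl (scalar s t) (gen (s ⊔ᵛ t)
              (≤-trans (+-mono-≤ a≤ b≤) (weight-⊔ s t (λ i bad-s bad-t → ¬shared (i , bad-s , bad-t))))))

      Span≥-⊙ : ∀ {a b A B} → Span≥ a A → Span≥ b B → Span≥ (a +ℕ b) (A ⊙ B)
      Span≥-⊙ (gen s a≤) (gen t b≤) = T-⊙-Span≥ s t a≤ b≤
      Span≥-⊙ (gen s a≤) zer        = resp (≈M.sym (⊙-zeroʳ _)) zer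
      Span≥-⊙ (gen s a≤) (add P Q)  = resp (≈M.sym (⊙-distribˡ _ _ _)) (add (Span≥-⊙ (gen s a≤) P) (Span≥-⊙ (gen s a≤) Q))
      Span≥-⊙ (gen s a≤) (scl t P)  = resp (≈M.sym (⊙-·ʳ _ _ _)) (scl t (Span≥-⊙ (gen s a≤) P))
      Span≥-⊙ (gen s a≤) (resp B≈B′ P) = resp (⊙-cong ≈M.refl B≈B′) (Span≥-⊙ (gen s a≤) P)
      Span≥-⊙ zer          Q = resp (≈M.sym (⊙-zeroˡ _)) zer
      Span≥-⊙ (add P P′)   Q = resp (≈M.sym (⊙-distribʳ _ _ _)) (add (Span≥-⊙ P Q) (Span≥-⊙ P′ Q))
      Span≥-⊙ (scl t P)    Q = resp (≈M.sym (⊙-·ˡ _ _ _)) (scl t (Span≥-⊙ P Q))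
      Span≥-⊙ (resp A≈A′ P) Q = resp (⊙-cong A≈A′ ≈M.refl) (Span≥-⊙ P Q)

      Span≥-⊙-Id : ∀ {w A} → Span≥ w A → Span≥ w (A ⊙ Id)
      Span≥-⊙-Id (gen s w≤)     = resp (≈M.sym (T-⊙-Id s)) (gen s w≤)
      Span≥-⊙-Id zer            = resp (≈M.sym (⊙-zeroˡ _)) zer
      Span≥-⊙-Id (add P Q)      = resp (≈M.sym (⊙-distribʳ _ _ _)) (add (Span≥-⊙-Id P) (Span≥-⊙-Id Q))
      Span≥-⊙-Id (scl t P)      = resp (≈M.sym (⊙-·ˡ _ _ _)) (scl t (Span≥-⊙-Id P))
      Span≥-⊙-Id (resp A≈A′ P)  = resp (⊙-cong A≈A′ ≈M.refl) (Span≥-⊙-Id P)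

      Span≥-vanishes : ∀ {w A} → (∀ s → weight s < w) → Span≥ w A → A ≈M O
      Span≥-vanishes small (gen s w≤)    = contradiction w≤ (<⇒≱ (small s))
      Span≥-vanishes small zer           = ≈M.refl
      Span≥-vanishes small (add P Q)     y z =
        trans (+-cong (Span≥-vanishes small P y z) (Span≥-vanishes small Q y z)) (+-identityˡ _)
      Span≥-vanishes small (scl t P)     y z = trans (*-congˡ (Span≥-vanishes small P y z)) (zeroʳ _)
      Span≥-vanishes small (resp A≈A′ P) = ≈M.trans (≈M.sym A≈A′) (Span≥-vanishes small P)

      Span≥-sumMats : ∀ {w} {A : Set} (f : A → Mat) xs → (∀ a → Span≥ w (f a)) → Span≥ w (sumMats (map f xs))
      Span≥-sumMats f []       f∈ = zer
      Span≥-sumMats f (a ∷ xs) f∈ = add (f∈ a) (Span≥-sumMats f xs f∈)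

      EAE-Span≥0 : ∀ a → Span≥ 0 (EAE a)
      EAE-Span≥0 a = resp (≈M.sym (EAE-expansion a))
                          (Span≥-sumMats _ shapeVectors (λ σ → scl _ (gen σ z≤n)))

      corner⊆Span≥0 : ∀ {A} → InETE g A → Span≥ 0 A
      corner⊆Span≥0 (B , B∈T , A≈EBE) =
        resp (≈M.sym (≈M.trans A≈EBE (representation _ (InT-respects≡ EBE∈T) (InT-invariant EBE∈T)
                                                        (corner-supported B))))
             (Span≥-sumMats _ allE (λ a → scl _ (EAE-Span≥0 a)))
        where EBE∈T = mul (mul (genE g) B∈T) (genE g)

      ℐ⊆Span≥1 : ∀ {A} → InI g A → Span≥ 1 A
      ℐ⊆Span≥1 (gen τ valid kτ≈0) = resp (≈M.sym (B-shape τ valid)) (gen (shapeOfτ τ) has-bad)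
        where
        has-bad : 1 ≤ weight (shapeOfτ τ)
        has-bad with any? (bad? (shapeOfτ τ))
        ... | yes (i , bad) = ∈⇒count≥1 (bad? (shapeOfτ τ)) (allFinL n) (∈-allFin i) bad
        ... | no no-bad     = contradiction (trans (sym (ι-k τ valid)) kτ≈0)
                                            (∏-nonzero _ (λ i ικ≈0 → no-bad (i , ι≈0⇒∣ _ ικ≈0)))
      ℐ⊆Span≥1 zer           = zer
      ℐ⊆Span≥1 (add P Q)     = add (ℐ⊆Span≥1 P) (ℐ⊆Span≥1 Q)
      ℐ⊆Span≥1 (scl t P)     = scl t (ℐ⊆Span≥1 P)
      ℐ⊆Span≥1 (resp A≈C P)  = resp A≈C (ℐ⊆Span≥1 P)

      Span≥1⊆ℐ : (∀ i → 2 ≤ L i) → (∀ i → 2 ≤ M i) → ∀ {A} → Span≥ 1 A → InI g A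
      Span≥1⊆ℐ 2≤L 2≤M (gen s 1≤weight) with count≥1⇒∃ (bad? s) (allFinL n) 1≤weight
      ... | i , bad = resp (≈M.trans (B-shape (τOf s) (τOf-valid s)) (T-τOf s)) (gen (τOf s) (τOf-valid s) kτ≈0)
        where
        kτ≈0 : ι F (k (τOf s)) ≈ 0#
        kτ≈0 = trans (ι-k (τOf s) (τOf-valid s))
                     (∏-zero _ i (trans (reflexive (≡.cong (ι F) (κ-τOf 2≤L 2≤M s i))) (∣⇒ι≈0 _ bad)))
      Span≥1⊆ℐ 2≤L 2≤M zer          = zer
      Span≥1⊆ℐ 2≤L 2≤M (add P Q)    = add (Span≥1⊆ℐ 2≤L 2≤M P) (Span≥1⊆ℐ 2≤L 2≤M Q)
      Span≥1⊆ℐ 2≤L 2≤M (scl t P)    = scl t (Span≥1⊆ℐ 2≤L 2≤M P)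
      Span≥1⊆ℐ 2≤L 2≤M (resp A≈C P) = resp A≈C (Span≥1⊆ℐ 2≤L 2≤M P)

      ℐ-ideal : (∀ i → 2 ≤ L i) → (∀ i → 2 ≤ M i) → IsTwoSidedIdeal (InETE g) (InI g)
      ℐ-ideal 2≤L 2≤M = record
        { sub   = λ _ → ℐ⊆corner
        ; zero∈ = zer
        ; +∈    = λ _ _ → add
        ; ·∈    = λ t _ → scl t
        ; left  = λ _ _ A∈ℐ C∈corner → Span≥1⊆ℐ 2≤L 2≤M (Span≥-⊙ (corner⊆Span≥0 C∈corner) (ℐ⊆Span≥1 A∈ℐ))
        ; right = λ _ _ A∈ℐ C∈corner → Span≥1⊆ℐ 2≤L 2≤M (Span≥-⊙ (ℐ⊆Span≥1 A∈ℐ) (corner⊆Span≥0 C∈corner))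
        }

      BadAt₁ BadAt₂ : Fin n → Set
      BadAt₁ a = g a ≡ 𝟙 × p ∣ (M a ∸ 1)
      BadAt₂ a = g a ≡ 𝟚 × p ∣ ((L a ∸ 1) *ℕ M a)

      badAt₁? : Decidable BadAt₁
      badAt₁? a = (g a ≟F 𝟙) ×-dec (p ∣? (M a ∸ 1))

      badAt₂? : Decidable BadAt₂
      badAt₂? a = (g a ≟F 𝟚) ×-dec (p ∣? ((L a ∸ 1) *ℕ M a))

      c₁ c₂ : ℕ
      c₁ = count badAt₁? (allFinL n)
      c₂ = count badAt₂? (allFinL n)

      p∤1 : ¬ (p ∣ 1)
      p∤1 p∣1 = 1≉0 (trans (sym ι-1) (∣⇒ι≈0 1 p∣1))

      Bad⇒BadAt : ∀ s i → Bad s i → BadAt₁ i ⊎ BadAt₂ i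
      Bad⇒BadAt s i bad with C.κ-cases i (g i) (s i)
      ... | inj₁ κ≡1                  = contradiction (≡.subst (p ∣_) κ≡1 bad) p∤1
      ... | inj₂ (inj₁ (G≡𝟙 , κ≡m-1)) = inj₁ (G≡𝟙 , ≡.subst (p ∣_) κ≡m-1 bad)
      ... | inj₂ (inj₂ (G≡𝟚 , κ∣))    = inj₂ (G≡𝟚 , ∣-trans bad κ∣)

      weight-bound : ∀ s → weight s ≤ c₁ +ℕ c₂
      weight-bound s = count-⊆-+ (bad? s) badAt₁? badAt₂? (Bad⇒BadAt s) (allFinL n)

      prodV-Span≥ : ∀ {h} (As : Vec Mat (suc h)) → All (InI g) As → Span≥ (suc h) (prodV As)
      prodV-Span≥ (A ∷ [])     (A∈ℐ ∷ [])  = Span≥-⊙-Id (ℐ⊆Span≥1 A∈ℐ)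
      prodV-Span≥ (A ∷ B ∷ As) (A∈ℐ ∷ As∈ℐ) = Span≥-⊙ (ℐ⊆Span≥1 A∈ℐ) (prodV-Span≥ (B ∷ As) As∈ℐ)

      long-products-vanish : ProdsZero (InI g) (suc (c₁ +ℕ c₂))
      long-products-vanish As As∈ℐ = Span≥-vanishes (λ s → s≤s (weight-bound s)) (prodV-Span≥ As As∈ℐ)

      badList : List (Fin n)
      badList = filter badAt₁? (allFinL n) ++ filter badAt₂? (allFinL n)

      badList-unique : Unique badList
      badList-unique = Unique.++⁺ (Unique.filter⁺ badAt₁? (Unique.allFin⁺ n)) (Unique.filter⁺ badAt₂? (Unique.allFin⁺ n))
        (λ (d∈₁ , d∈₂) → 𝟙≢𝟚 (≡.trans (≡.sym (proj₁ (proj₂ (∈-filter⁻ badAt₁? {xs = allFinL n} d∈₁))))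
                                      (proj₁ (proj₂ (∈-filter⁻ badAt₂? {xs = allFinL n} d∈₂)))))
        where
        𝟙≢𝟚 : 𝟙 ≢ 𝟚
        𝟙≢𝟚 ()

      badList-bad : ∀ d → d ∈ₗ badList → BadAt₁ d ⊎ BadAt₂ d
      badList-bad d d∈ with ∈-++⁻ (filter badAt₁? (allFinL n)) d∈
      ... | inj₁ d∈₁ = inj₁ (proj₂ (∈-filter⁻ badAt₁? {xs = allFinL n} d∈₁))
      ... | inj₂ d∈₂ = inj₂ (proj₂ (∈-filter⁻ badAt₂? {xs = allFinL n} d∈₂))

      single-bad : ∀ d → BadAt₁ d ⊎ BadAt₂ d → Bad (single d) d
      single-bad d badAt = ≡.subst (λ t → p ∣ C.κ d (g d) t) (≡.sym single-self) (κ-full badAt)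
        where
        single-self : single d d ≡ full
        single-self = ≡.cong (if_then full else diag) (dec-true (d ≟F d) ≡.refl)
        κ-full : BadAt₁ d ⊎ BadAt₂ d → p ∣ C.κ d (g d) full
        κ-full (inj₁ (G≡𝟙 , p∣)) = ≡.subst (λ G → p ∣ C.κ d G full) (≡.sym G≡𝟙) p∣
        κ-full (inj₂ (G≡𝟚 , p∣)) = ≡.subst (λ G → p ∣ C.κ d G full) (≡.sym G≡𝟚) p∣

      generators∈ℐ : ∀ r ds le → (∀ d → d ∈ₗ ds → InI g (T (single d))) → All (InI g) (generators r ds le)
      generators∈ℐ zero    _        _        _    = []
      generators∈ℐ (suc r) (d ∷ ds) (s≤s le) ds∈ℐ = ds∈ℐ d (here ≡.refl) ∷ generators∈ℐ r ds le (λ d′ → ds∈ℐ d′ ∘ there)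

      short-products-survive : (∀ i → 2 ≤ L i) → (∀ i → 2 ≤ M i) → ∀ r → suc r ≤ c₁ +ℕ c₂ → ¬ ProdsZero (InI g) (suc r)
      short-products-survive 2≤L 2≤M r r<c products-vanish =
        let s , prod≈T , _ = generators-product r badList le badList-unique
            y , y∈         = InRg-nonempty 2≤L 2≤M
        in 1≉0 (begin
          1#                                        ≈⟨ T-diagonal s y∈ ⟨
          T s y y                                   ≈⟨ prod≈T y y ⟨
          prodV (generators (suc r) badList le) y y ≈⟨ products-vanish _ (generators∈ℐ (suc r) badList le single∈ℐ) y y ⟩
          0#                                        ∎)
        where
        open import Relation.Binary.Reasoning.Setoid setoid
        le : suc r ≤ length badList
        le = ≤-trans r<c (≤-reflexive (≡.sym (length-++ (filter badAt₁? (allFinL n)))))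
        single∈ℐ : ∀ d → d ∈ₗ badList → InI g (T (single d))
        single∈ℐ d d∈ = Span≥1⊆ℐ 2≤L 2≤M
          (gen (single d) (∈⇒count≥1 (bad? (single d)) (allFinL n) (∈-allFin d) (single-bad d (badList-bad d d∈))))

      claimedIndex≡ : claimedIndex p g ≡ suc (c₁ +ℕ c₂)
      claimedIndex≡ = ℕₚ.+-comm (c₁ +ℕ c₂) 1

      ℐ-nilpotentIndex : (∀ i → 2 ≤ L i) → (∀ i → 2 ≤ M i) → NilpotentIndex (InI g) (claimedIndex p g)
      ℐ-nilpotentIndex 2≤L 2≤M rewrite claimedIndex≡ =
        s≤s z≤n , long-products-vanish , λ { (suc r) _ (s≤s r<c) → short-products-survive 2≤L 2≤M r r<c }

lemma5p5 : ∀ {c ℓ} (F : Field c ℓ) (p : ℕ) → IsCharacteristic F p →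
    (n : ℕ) → 1 ≤ n → (L M : Fin n → ℕ) → (∀ i → 2 ≤ L i) → (∀ i → 2 ≤ M i) →
    (x : Pt n L M) → (g : E n) →
    Scheme.IsTwoSidedIdeal F n L M x (Scheme.InETE F n L M x g) (Scheme.InI F n L M x g)
    × Scheme.NilpotentIndex F n L M x (Scheme.InI F n L M x g) (Scheme.claimedIndex F n L M x p g)
lemma5p5 F p char n _ L M 2≤L 2≤M x g = ℐ-ideal 2≤L 2≤M , ℐ-nilpotentIndex 2≤L 2≤M
  where open ProductScheme.Corner.Weights F n L M x g p char
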